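{- Let $\beta=(\beta_L)_{L\in\mathbb{N}}$ be a sequence of integers with $\beta_L\ge 2$, let $k\ge1$, $\mathcal{P}_{\mathrm{mis}}=\mathbb{N}^k\setminus\{(0,\dots,0)\}$, and let $\varphi^{\beta,k}:\mathcal{P}_{\mathrm{mis}}\to\mathbb{N}$ be $\varphi^{\beta,k}(X)=(x^0\oplus\cdots\oplus x^{k-1})\oplus(B_{\mathrm{mord}_\beta(X)+1}-1)$. Then $\Delta(\varphi^{\beta,k})\neq\emptyset$ and $$\mathrm{wt}(\varphi^{\beta,k})=\max_{L\in\mathbb{N}}\ \min\Big\{\beta_L-\delta(L),\ k-\delta(L)\,[\beta_0<2k]\Big\},$$ where $\delta(L)=[L=0]$ and $[P]$ is $1$ if $P$ holds and $0$ otherwise. Equivalently, with $\mathbf{B}=\sup\{\beta_L: L\ge 1\}\in\mathbb{N}\cup\{\infty\}$, $$\mathrm{wt}(\varphi^{\beta,k})=\begin{cases}k & \text{if } \mathbf{B}\ge k \text{ or } \beta_0\ge 2k,\\ k-1 & \text{if } \mathbf{B}<k \text{ and } k\le\beta_0<2k,\\ \max\{\beta_0-1,\mathbf{B}\} & \text{if } \mathbf{B}<k \text{ and } \beta_0<k.\end{cases}$$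
   Context: $\mathbb{N}$ denotes the nonnegative integers; $B_L=\beta_0\cdots\beta_{L-1}$; each $n\in\mathbb{N}$ is written $n=\sum_L n_LB_L$ with digits $n_L\in\{0,\dots,\beta_L-1\}$; $a\oplus b$ is the nonnegative integer with $L$-th digit $(a_L+b_L)\bmod\beta_L$. $\mathrm{ord}_\beta(n)=\min\{L:n_L\ne0\}$ ($\infty$ if $n=0$), and $\mathrm{mord}_\beta(X)=\min_i\mathrm{ord}_\beta(x^i)$ for $X=(x^0,\dots,x^{k-1})$. For $\mathcal{P}\subseteq\mathbb{N}^k$ and $\mathcal{C}\subseteq\mathbb{N}^k\setminus\{0\}$, $\Gamma(\mathcal{P},\mathcal{C})$ is the game on positions $\mathcal{P}$ where $Y$ is an option of $X$ iff $X,Y\in\mathcal{P}$ and $X-Y\in\mathcal{C}$; its Sprague–Grundy function is $\mathrm{sg}(X)=\mathrm{mex}\{\mathrm{sg}(Y):Y\text{ option of }X\}$. For a function $\psi:\mathcal{P}\to\mathbb{N}$, $\Delta(\psi)$ is the set of all $\mathcal{C}\subseteq\mathbb{N}^k\setminus\{0\}$ such that the Sprague–Grundy function of $\Gamma(\mathcal{P},\mathcal{C})$ equals $\psi$; for nonempty $\Delta(\psi)$, $\mathrm{wt}(\psi)=\min_{\mathcal{C}\in\Delta(\psi)}\mathrm{wt}(\mathcal{C})$, where $\mathrm{wt}(\mathcal{C})=\max\{\mathrm{wt}(C):C\in\mathcal{C}\}$ ($\max\emptyset=0$) and $\mathrm{wt}(C)$ is the number of nonzero components of $C$. Here $\mathcal{P}=\mathcal{P}_{\mathrm{mis}}$.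 -}

module Defs where

open import Level using (0ℓ)
open import Data.Bool using (Bool; true; false; if_then_else_; not)
open import Data.Nat using (ℕ; zero; suc; _+_; _*_; _∸_; _≤_; _<_; _⊓_; z≤n; s≤s; NonZero; >-nonZero; _/_; _%_; _<ᵇ_; _≡ᵇ_)
open import Data.Nat.Properties using (≤-trans; m*n≢0)
open import Data.Fin using (Fin)
open import Data.Maybe using (Maybe; just; nothing)
open import Data.Product using (Σ; ∃; ∃-syntax; _×_; _,_)
open import Data.Vec.Functional using (Vector; foldr)
open import Relation.Nullary using (¬_)
open import Relation.Binary.PropositionalEquality using (_≡_; _≢_)
open import Relation.Unary using (Pred)

sumTo : ℕ → (ℕ → ℕ) → ℕ
sumTo zero    f = 0
sumTo (suc n) f = sumTo n f + f n

-- least L < fuel with p L ≡ true (returns fuel if there is none)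
search : (ℕ → Bool) → ℕ → ℕ
search p zero    = zero
search p (suc f) = if p 0 then 0 else suc (search (λ L → p (suc L)) f)

-- minimum on ℕ ∪ {∞}, with ∞ represented by nothing
min∞ : Maybe ℕ → Maybe ℕ → Maybe ℕ
min∞ nothing  y        = y
min∞ (just a) nothing  = just a
min∞ (just a) (just b) = just (a ⊓ b)

⟦_⟧ : Bool → ℕ
⟦ true ⟧  = 1
⟦ false ⟧ = 0

IsMaxOf : (ℕ → ℕ) → ℕ → Set
IsMaxOf f m = (∃[ L ] f L ≡ m) × (∀ L → f L ≤ m)

B : (ℕ → ℕ) → ℕ → ℕ
B β zero    = 1
B β (suc L) = B β L * β L

module Mixed (β : ℕ → ℕ) (hβ : ∀ L → 2 ≤ β L) where

  β-nz : ∀ L → NonZero (β L)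
  β-nz L = >-nonZero (≤-trans (s≤s z≤n) (hβ L))

  B-nz : ∀ L → NonZero (B β L)
  B-nz zero    = _
  B-nz (suc L) = m*n≢0 (B β L) (β L) {{B-nz L}} {{β-nz L}}

  -- the L-th digit n_L of n, so that n = Σ_L n_L B_L with 0 ≤ n_L < β_L
  digit : ℕ → ℕ → ℕ
  digit n L = _%_ (_/_ n (B β L) {{B-nz L}}) (β L) {{β-nz L}}

  -- a ⊕ b : the number whose L-th digit is (a_L + b_L) mod β_L.
  -- Digits of a and b vanish for L ≥ a + b (since B_L ≥ 2^L > L),
  -- so the finite sum over L < a + b is the full digit expansion.
  _⊕_ : ℕ → ℕ → ℕ
  a ⊕ b = sumTo (a + b) (λ L → _%_ (digit a L + digit b L) (β L) {{β-nz L}} * B β L)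

  -- ord_β(n) = min{L : n_L ≠ 0}, ∞ (= nothing) if n = 0.
  -- For n ≥ 1 the least such L is < n, so a search bounded by n suffices.
  ord : ℕ → Maybe ℕ
  ord zero        = nothing
  ord n@(suc _)   = just (search (λ L → not (digit n L ≡ᵇ 0)) n)

  Pos : ℕ → Set
  Pos k = Vector ℕ k

  mord : ∀ {k} → Pos k → Maybe ℕ
  mord X = foldr (λ x m → min∞ (ord x) m) nothing X

  -- φ^{β,k}(X) = (x^0 ⊕ ⋯ ⊕ x^{k-1}) ⊕ (B_{mord(X)+1} − 1)
  -- (only meaningful on P_mis, where mord X is finite; value 0 at X = 0 is irrelevant)
  φ : (k : ℕ) → Pos k → ℕ
  φ k X with mord X
  ... | nothing = 0
  ... | just m  = foldr _⊕_ 0 X ⊕ (B β (m + 1) ∸ 1)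

Vec' : ℕ → Set
Vec' k = Vector ℕ k

InPmis : ∀ {k} → Vec' k → Set
InPmis X = ∃[ i ] X i ≢ 0

IsMoveSet : ∀ {k} → Pred (Vec' k) 0ℓ → Set
IsMoveSet C = ∀ c → C c → InPmis c

Option : ∀ {k} → Pred (Vec' k) 0ℓ → Vec' k → Vec' k → Set
Option C X Y = InPmis X × InPmis Y × (∃[ c ] (C c × (∀ i → X i ≡ Y i + c i)))

IsMex : Pred ℕ 0ℓ → ℕ → Set
IsMex S m = (¬ S m) × (∀ j → j < m → S j)

-- ψ is the Sprague–Grundy function of Γ(P_mis, C):
-- sg(X) = mex{ sg(Y) : Y option of X } for all X ∈ P_mis
-- (this recursion determines sg uniquely, as moves strictly decrease Σ_i x^i)
IsSGof : ∀ {k} → Pred (Vec' k) 0ℓ → (Vec' k → ℕ) → Set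
IsSGof C ψ = ∀ X → InPmis X → IsMex (λ v → ∃[ Y ] (Option C X Y × ψ Y ≡ v)) (ψ X)

InΔ : ∀ {k} → (Vec' k → ℕ) → Pred (Vec' k) 0ℓ → Set
InΔ ψ C = IsMoveSet C × IsSGof C ψ

wtv : ∀ {k} → Vec' k → ℕ
wtv c = foldr (λ x acc → ⟦ not (x ≡ᵇ 0) ⟧ + acc) 0 c

WtSetLE : ∀ {k} → Pred (Vec' k) 0ℓ → ℕ → Set
WtSetLE C w = ∀ c → C c → wtv c ≤ w

-- wt(ψ) = w, i.e. min_{C ∈ Δ(ψ)} wt(C) = w
WtEq : ∀ {k} → (Vec' k → ℕ) → ℕ → Set₁
WtEq ψ w = (Σ (Pred _ 0ℓ) λ C → InΔ ψ C × WtSetLE C w)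
         × (∀ C → InΔ ψ C → ∀ m → WtSetLE C m → w ≤ m)

fβk : (ℕ → ℕ) → ℕ → ℕ → ℕ
fβk β k L = (β L ∸ δ) ⊓ (k ∸ δ * ⟦ β 0 <ᵇ 2 * k ⟧)
  where
  δ = ⟦ L ≡ᵇ 0 ⟧

module Submission where

open import Defs
open import Data.Nat using (ℕ; _≤_)
open import Data.Product using (Σ; _×_)
open import Relation.Unary using (Pred)
open import Level using (0ℓ)

open import Data.Nat using (zero; suc; _+_; _*_; _∸_; _<_; _⊓_; z≤n; s≤s; NonZero; >-nonZero⁻¹; _/_; _%_; _≡ᵇ_; _<ᵇ_; _≤′_; ≤′-refl; ≤′-step; _≟_; _<?_; _≤?_)
open import Data.Nat.Properties
open import Data.Nat.DivMod
open import Data.Nat.Divisibility using (_∣_; ∣-refl; ∣-trans; m∣m*n; m%n≡0⇒n∣m)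
open import Data.Nat.Tactic.RingSolver using (solve-∀)
open import Algebra.Properties.CommutativeSemigroup +-commutativeSemigroup using (xy∙z≈xz∙y) renaming (interchange to +-interchange)
open import Data.Product using (proj₁; proj₂; _,_; ∃)
open import Data.Unit using (tt)
open import Data.Sum using (_⊎_; inj₁; inj₂; [_,_]′)
open import Data.Bool using (Bool; true; false; not; T)
open import Data.Fin using (Fin; toℕ) renaming (zero to fz; suc to fs)
import Data.Fin.Properties as FP
open import Data.Maybe using (just; nothing)
open import Data.Vec.Functional using (Vector; foldr; _∷_; updateAt)
open import Data.Vec.Functional.Properties using (updateAt-updates; updateAt-minimal; updateAt-updateAt)
open import Function using (const; _∘_)
open import Relation.Nullary using (¬_; yes; no; Dec; contradiction)
open import Relation.Nullary.Decidable using (¬?; _⊎-dec_; decidable-stable)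
open import Relation.Binary using (tri<; tri≈; tri>)
open import Relation.Binary.PropositionalEquality

-- Write digitSum X p = Σᵢ (x^i)_p. The p-th digit of φ X is
-- (digitSum X p + [p ≤ mord X]·(β_p − 1)) mod β_p (digit-φ), since ⊕ adds digitwise and
-- B_{m+1} − 1 has digit β_p − 1 exactly at the levels p ≤ m.
--
-- Call a move c critical if for some level q all components of c vanish below q and
-- digitSum c q ≢ 0 (mod β_q). A critical move always changes φ, because an option agrees with X
-- below q, so the q-th digits of φ differ by digitSum c q (critical-changes-φ). Conversely every
-- v < φ X is the value of an option reached by a critical move of weight ≤ w, for any w ≥ f(β,k,L)
-- for all L (smaller-values-reachable): compare v and φ X at their top differing level L, remove the
-- right amount from the digits at level L (or at mord X if L ≤ mord X), and rebuild the lower digits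
-- of one component (module Candidate). Hence the critical moves of weight ≤ w are in Δ(φ).
--
-- (Here f(β,k,L) = min{β_L − δ(L), k − δ(L)[β_0 < 2k]} is fβk β k L.)
--
-- For each level L there is a position X with φ X ≠ 0 all of whose moves to a
-- position of value 0 have weight ≥ f(β,k,L) (witness-above0, witness-level0-twos,
-- witness-level0-ones). As 0 = mex must be an option value of X, every C ∈ Δ(φ) has a move of
-- that weight (witness⇒weight≥).

%-absorbʳ : ∀ a b n .{{_ : NonZero n}} → (a + b % n) % n ≡ (a + b) % n
%-absorbʳ a b n = begin
  (a + b % n) % n           ≡⟨ %-distribˡ-+ a (b % n) n ⟩
  (a % n + b % n % n) % n   ≡⟨ cong (λ t → (a % n + t) % n) (m%n%n≡m%n b n) ⟩
  (a % n + b % n) % n       ≡⟨ %-distribˡ-+ a b n ⟨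
  (a + b) % n               ∎
  where open ≡-Reasoning

%-absorbˡ : ∀ a b n .{{_ : NonZero n}} → (a % n + b) % n ≡ (a + b) % n
%-absorbˡ a b n = begin
  (a % n + b) % n   ≡⟨ cong (_% n) (+-comm (a % n) b) ⟩
  (b + a % n) % n   ≡⟨ %-absorbʳ b a n ⟩
  (b + a) % n       ≡⟨ cong (_% n) (+-comm b a) ⟩
  (a + b) % n       ∎
  where open ≡-Reasoning

[r+kd]/d≡k : ∀ r k d .{{_ : NonZero d}} → r < d → (r + k * d) / d ≡ k
[r+kd]/d≡k r k d r<d = trans (+-distrib-/ r (k * d) lt) (cong₂ _+_ (m<n⇒m/n≡0 r<d) (m*n/n≡m k d))
  where
  lt : r % d + (k * d) % d < d
  lt = subst (_< d) (sym (cong₂ _+_ (m<n⇒m%n≡m r<d) (m*n%n≡0 k d))) (subst (_< d) (sym (+-identityʳ r)) r<d)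

[r+kd]%d≡r : ∀ r k d .{{_ : NonZero d}} → r < d → (r + k * d) % d ≡ r
[r+kd]%d≡r r k d r<d = trans ([m+kn]%n≡m%n r k d) (m<n⇒m%n≡m r<d)

[a+b]%n≡a%n⇒b%n≡0 : ∀ a b n .{{_ : NonZero n}} → (a + b) % n ≡ a % n → b % n ≡ 0
[a+b]%n≡a%n⇒b%n≡0 a b n eq with a % n + b % n <? n
... | yes lt = +-cancelˡ-≡ (a % n) _ _ (trans sum≡ (sym (+-identityʳ _)))
  where
  sum≡ : a % n + b % n ≡ a % n
  sum≡ = trans (sym (m<n⇒m%n≡m lt)) (trans (sym (%-distribˡ-+ a b n)) eq)
... | no nlt = contradiction rb≡n (<⇒≢ (m%n<n b n))
  where
  -- otherwise a%n + b%n = a%n + n, forcing b%n = n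
  ra = a % n
  rb = b % n
  n≤ : n ≤ ra + rb
  n≤ = ≮⇒≥ nlt
  wrapped< : ra + rb ∸ n < n
  wrapped< = +-cancelʳ-< n _ n (subst (_< n + n) (sym (m∸n+n≡m n≤)) (+-mono-< (m%n<n a n) (m%n<n b n)))
  wrapped≡ : ra + rb ∸ n ≡ ra
  wrapped≡ = trans (sym (m<n⇒m%n≡m wrapped<))
               (trans (m≤n⇒[n∸m]%m≡n%m n≤) (trans (sym (%-distribˡ-+ a b n)) eq))
  rb≡n : rb ≡ n
  rb≡n = +-cancelˡ-≡ ra _ _ (trans (sym (m∸n+n≡m n≤)) (cong (_+ n) wrapped≡))

[m∸d]%n≡m%n∸d : ∀ m d n .{{_ : NonZero n}} → d ≤ m % n → (m ∸ d) % n ≡ m % n ∸ d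
[m∸d]%n≡m%n∸d m d n d≤ = trans (cong (_% n) m∸d≡) ([r+kd]%d≡r (m % n ∸ d) (m / n) n lt)
  where
  m∸d≡ : m ∸ d ≡ (m % n ∸ d) + m / n * n
  m∸d≡ = trans (cong (_∸ d) (m≡m%n+[m/n]*n m n)) (+-∸-comm (m / n * n) d≤)
  lt : m % n ∸ d < n
  lt = ≤-<-trans (m∸n≤m _ d) (m%n<n m n)

[1+v+[n∸1]]%n≡v : ∀ v n .{{_ : NonZero n}} → v < n → (suc v + (n ∸ 1)) % n ≡ v
[1+v+[n∸1]]%n≡v v (suc n) lt = trans (cong (_% suc n) (sym (+-suc v n))) (trans ([m+n]%n≡m%n v (suc n)) (m<n⇒m%n≡m lt))

[s+[n∸1]]%n≡v : ∀ s v n .{{_ : NonZero n}} → v < n → s % n ≡ suc v % n → (s + (n ∸ 1)) % n ≡ v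
[s+[n∸1]]%n≡v s v n v<n s≡ = begin
  (s + (n ∸ 1)) % n              ≡⟨ %-absorbˡ s (n ∸ 1) n ⟨
  (s % n + (n ∸ 1)) % n          ≡⟨ cong (λ t → (t + (n ∸ 1)) % n) s≡ ⟩
  (suc v % n + (n ∸ 1)) % n      ≡⟨ %-absorbˡ (suc v) (n ∸ 1) n ⟩
  (suc v + (n ∸ 1)) % n          ≡⟨ [1+v+[n∸1]]%n≡v v n v<n ⟩
  v                              ∎
  where open ≡-Reasoning

n∸1<n : ∀ n .{{_ : NonZero n}} → n ∸ 1 < n
n∸1<n (suc n) = n<1+n n

<⇒≤∸1 : ∀ {m n} → m < n → m ≤ n ∸ 1
<⇒≤∸1 {n = suc n} (s≤s le) = le

<∧≢∸1⇒1+< : ∀ {m n} → m < n → m ≢ n ∸ 1 → suc m < n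
<∧≢∸1⇒1+< {m} {suc n} (s≤s m≤n) m≢n = s≤s (≤∧≢⇒< m≤n m≢n)

[s+[n∸1]]%n≡0⇒s≡1 : ∀ {s n} .{{_ : NonZero n}} → 2 ≤ n → s < n → (s + (n ∸ 1)) % n ≡ 0 → s ≡ 1
[s+[n∸1]]%n≡0⇒s≡1 {zero} {n} 2≤n _ eq = contradiction (m∸n≡0⇒m≤n (trans (sym (m<n⇒m%n≡m (n∸1<n n))) eq)) (<⇒≱ 2≤n)
[s+[n∸1]]%n≡0⇒s≡1 {suc s} {n} _ s<n eq = cong suc (trans (sym ([1+v+[n∸1]]%n≡v s n (<-trans (n<1+n s) s<n))) eq)

m≤n∧m%n≡1⇒m≡1 : ∀ {m n} .{{_ : NonZero n}} → m ≤ n → m % n ≡ 1 → m ≡ 1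
m≤n∧m%n≡1⇒m≡1 {m} {n} m≤n m%n≡1 with m≤n⇒m<n∨m≡n m≤n
... | inj₁ m<n = trans (sym (m<n⇒m%n≡m m<n)) m%n≡1
... | inj₂ refl = contradiction (trans (sym (n%n≡0 m)) m%n≡1) 0≢1+n

m%n≡0⇒n≤m : ∀ m n .{{_ : NonZero n}} → m % n ≡ 0 → m ≢ 0 → n ≤ m
m%n≡0⇒n≤m m n m%n≡0 m≢0 = m/n≢0⇒n≤m λ q≡0 → m≢0 (trans (m≡m%n+[m/n]*n m n) (cong₂ _+_ m%n≡0 (cong (_* n) q≡0)))

m%n≡0⇒2n≤m : ∀ m n .{{_ : NonZero n}} → m % n ≡ 0 → n < m → n + n ≤ m
m%n≡0⇒2n≤m m n m%n≡0 n<m = subst (n + n ≤_) (sym m≡qn) (≤-trans (≤-reflexive 2n≡) (*-monoˡ-≤ n 2≤q))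
  where
  q = m / n
  m≡qn : m ≡ q * n
  m≡qn = trans (m≡m%n+[m/n]*n m n) (cong (_+ q * n) m%n≡0)
  2n≡ : n + n ≡ 2 * n
  2n≡ = cong (n +_) (sym (+-identityʳ n))
  2≤q : 2 ≤ q
  2≤q with q ≤? 1
  ... | no q≰1 = ≰⇒> q≰1
  ... | yes q≤1 = contradiction (≤-trans (≤-reflexive m≡qn) (≤-trans (*-monoˡ-≤ n q≤1) (≤-reflexive (+-identityʳ n)))) (<⇒≱ n<m)

-- Once n ≤ m, the quotient is at least 1.
m%n+n≤m : ∀ m n .{{_ : NonZero n}} → n ≤ m → m % n + n ≤ m
m%n+n≤m m n n≤m = subst (m % n + n ≤_) (sym (m≡m%n+[m/n]*n m n))
                    (+-monoʳ-≤ (m % n) (≤-trans (≤-reflexive (sym (+-identityʳ n))) (*-monoˡ-≤ n (m≥n⇒m/n>0 n≤m))))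

%≡suc⇒≢0 : ∀ {s n m} .{{_ : NonZero n}} → s % n ≡ suc m → s ≢ 0
%≡suc⇒≢0 {n = suc n} eq refl = 0≢1+n eq

least : (P : ℕ → Set) → (∀ p → Dec (P p)) → ∀ n →
        (∃ λ t → t < n × P t × (∀ p → p < t → ¬ P p)) ⊎ (∀ p → p < n → ¬ P p)
least P P? zero = inj₂ (λ p ())
least P P? (suc n) with least P P? n
... | inj₁ (t , t<n , Pt , below) = inj₁ (t , ≤-trans t<n (n≤1+n n) , Pt , below)
... | inj₂ none with P? n
...   | yes Pn = inj₁ (n , ≤-refl , Pn , none)
...   | no ¬Pn = inj₂ λ p p<1+n → [ none p , (λ { refl → ¬Pn }) ]′ (m≤n⇒m<n∨m≡n (≤-pred p<1+n))

search-least : ∀ (p : ℕ → Bool) f L → L < f → p L ≡ true → (∀ L' → L' < L → p L' ≡ false) → search p f ≡ L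
search-least p (suc f) zero lt pL below with p 0 | pL
... | true | _ = refl
search-least p (suc f) (suc L) (s≤s lt) pL below with p 0 | below 0 (s≤s z≤n)
... | false | _ = cong suc (search-least (λ L → p (suc L)) f L lt pL (λ L' l → below (suc L') (s≤s l)))

∑ : ∀ {k} → (Fin k → ℕ) → ℕ
∑ f = foldr _+_ 0 f

∑-cong : ∀ {k} {f g : Fin k → ℕ} → (∀ i → f i ≡ g i) → ∑ f ≡ ∑ g
∑-cong {zero} h = refl
∑-cong {suc k} h = cong₂ _+_ (h fz) (∑-cong (λ i → h (fs i)))

∑-mono : ∀ {k} {f g : Fin k → ℕ} → (∀ i → f i ≤ g i) → ∑ f ≤ ∑ g
∑-mono {zero} h = z≤n
∑-mono {suc k} h = +-mono-≤ (h fz) (∑-mono (λ i → h (fs i)))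

∑-mono-< : ∀ {k} {f g : Fin k → ℕ} → (∀ i → f i ≤ g i) → ∀ i → f i < g i → ∑ f < ∑ g
∑-mono-< {suc k} h fz lt = +-mono-<-≤ lt (∑-mono (λ i → h (fs i)))
∑-mono-< {suc k} h (fs i) lt = +-mono-≤-< (h fz) (∑-mono-< (λ i → h (fs i)) i lt)

∑-+ : ∀ {k} (f g : Fin k → ℕ) → ∑ (λ i → f i + g i) ≡ ∑ f + ∑ g
∑-+ {zero} f g = refl
∑-+ {suc k} f g = trans (cong (f fz + g fz +_) (∑-+ (λ i → f (fs i)) (λ i → g (fs i)))) (+-interchange (f fz) (g fz) _ _)

∑-const : ∀ {k} c → ∑ (λ (_ : Fin k) → c) ≡ k * c
∑-const {zero} c = refl
∑-const {suc k} c = cong (c +_) (∑-const {k} c)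

∑-zero : ∀ {k} {f : Fin k → ℕ} → (∀ i → f i ≡ 0) → ∑ f ≡ 0
∑-zero {zero} h = refl
∑-zero {suc k} h = cong₂ _+_ (h fz) (∑-zero (λ i → h (fs i)))

≤∑ : ∀ {k} (f : Fin k → ℕ) i → f i ≤ ∑ f
≤∑ f fz = m≤m+n _ _
≤∑ f (fs i) = ≤-trans (≤∑ (λ j → f (fs j)) i) (m≤n+m _ _)

∑≡0⇒≡0 : ∀ {k} (f : Fin k → ℕ) → ∑ f ≡ 0 → ∀ i → f i ≡ 0
∑≡0⇒≡0 f ∑≡0 i = n≤0⇒n≡0 (≤-trans (≤∑ f i) (≤-reflexive ∑≡0))

∑≢0⇒∃≢0 : ∀ {k} (f : Fin k → ℕ) → ∑ f ≢ 0 → ∃ λ i → f i ≢ 0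
∑≢0⇒∃≢0 {zero} f ∑≢0 = contradiction refl ∑≢0
∑≢0⇒∃≢0 {suc k} f ∑≢0 with f fz ≟ 0
... | no f0≢0 = fz , f0≢0
... | yes f0≡0 with ∑≢0⇒∃≢0 (λ i → f (fs i)) (λ rest≡0 → ∑≢0 (cong₂ _+_ f0≡0 rest≡0))
...   | i , fi≢0 = fs i , fi≢0

∑-lowerBound : ∀ {k} (f : Fin k → ℕ) d → (∀ i → d ≤ f i) → k * d ≤ ∑ f
∑-lowerBound {zero} f d h = z≤n
∑-lowerBound {suc k} f d h = +-mono-≤ (h fz) (∑-lowerBound (λ i → f (fs i)) d (λ i → h (fs i)))

∑-% : ∀ {k} (f : Fin k → ℕ) n .{{_ : NonZero n}} → ∑ (λ i → f i % n) % n ≡ ∑ f % n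
∑-% {zero} f n = refl
∑-% {suc k} f n = begin
  (f fz % n + ∑ (λ i → f (fs i) % n)) % n       ≡⟨ %-absorbʳ (f fz % n) _ n ⟨
  (f fz % n + ∑ (λ i → f (fs i) % n) % n) % n   ≡⟨ cong (λ t → (f fz % n + t) % n) (∑-% (λ i → f (fs i)) n) ⟩
  (f fz % n + ∑ (λ i → f (fs i)) % n) % n       ≡⟨ %-absorbʳ (f fz % n) _ n ⟩
  (f fz % n + ∑ (λ i → f (fs i))) % n           ≡⟨ %-absorbˡ (f fz) _ n ⟩
  (f fz + ∑ (λ i → f (fs i))) % n               ∎
  where open ≡-Reasoning

∑-∸ : ∀ {k} (f g : Fin k → ℕ) → (∀ i → g i ≤ f i) → ∑ (λ i → f i ∸ g i) ≡ ∑ f ∸ ∑ g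
∑-∸ f g g≤f = trans (sym (m+n∸n≡m _ (∑ g)))
                (cong (_∸ ∑ g) (trans (sym (∑-+ (λ i → f i ∸ g i) g)) (∑-cong (λ i → m∸n+n≡m (g≤f i)))))

set : ∀ {k} → Fin k → ℕ → (Fin k → ℕ) → Fin k → ℕ
set j x f = updateAt f j (const x)

set-self : ∀ {k} (j : Fin k) x f → set j x f j ≡ x
set-self j x f = updateAt-updates j f

set-other : ∀ {k} (j : Fin k) x f i → i ≢ j → set j x f i ≡ f i
set-other j x f i i≢j = updateAt-minimal i j f i≢j

∑-split : ∀ {k} (j : Fin k) f → ∑ f ≡ f j + ∑ (set j 0 f)
∑-split {suc k} fz f = refl
∑-split {suc k} (fs j) f = begin
  f fz + ∑ (λ i → f (fs i))            ≡⟨ cong (f fz +_) (∑-split j (λ i → f (fs i))) ⟩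
  f fz + (f (fs j) + R)                ≡⟨ +-assoc (f fz) (f (fs j)) R ⟨
  f fz + f (fs j) + R                  ≡⟨ cong (_+ R) (+-comm (f fz) (f (fs j))) ⟩
  f (fs j) + f fz + R                  ≡⟨ +-assoc (f (fs j)) (f fz) R ⟩
  f (fs j) + (f fz + R)                ∎
  where
  open ≡-Reasoning
  R = ∑ (set j 0 (λ i → f (fs i)))

∑-set : ∀ {k} (j : Fin k) x f → ∑ (set j x f) ≡ x + ∑ (set j 0 f)
∑-set j x f = trans (∑-split j (set j x f)) (cong₂ _+_ (set-self j x f) (∑-cong (updateAt-updateAt j f)))

∑-others≡0 : ∀ {k} (j : Fin k) f → ∑ (set j 0 f) ≡ 0 → ∀ i → i ≢ j → f i ≡ 0
∑-others≡0 j f ∑≡0 i i≢j = trans (sym (set-other j 0 f i i≢j)) (∑≡0⇒≡0 (set j 0 f) ∑≡0 i)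

nonzero : ℕ → ℕ
nonzero x = ⟦ not (x ≡ᵇ 0) ⟧

wtv≡∑nonzero : ∀ {k} (c : Fin k → ℕ) → wtv c ≡ ∑ (λ i → nonzero (c i))
wtv≡∑nonzero {zero} c = refl
wtv≡∑nonzero {suc k} c = cong (nonzero (c fz) +_) (wtv≡∑nonzero (λ i → c (fs i)))

nonzero≤1 : ∀ x → nonzero x ≤ 1
nonzero≤1 zero = z≤n
nonzero≤1 (suc x) = s≤s z≤n

nonzero≤ : ∀ x → nonzero x ≤ x
nonzero≤ zero = z≤n
nonzero≤ (suc x) = s≤s z≤n

nonzero-mono : ∀ {x y} → (x ≢ 0 → y ≢ 0) → nonzero x ≤ nonzero y
nonzero-mono {zero} h = z≤n
nonzero-mono {suc x} {zero} h = contradiction refl (h (λ ()))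
nonzero-mono {suc x} {suc y} h = ≤-refl

wtv-mono : ∀ {k} (c g : Fin k → ℕ) → (∀ i → c i ≢ 0 → g i ≢ 0) → wtv c ≤ wtv g
wtv-mono c g supp = begin
  wtv c                       ≡⟨ wtv≡∑nonzero c ⟩
  ∑ (λ i → nonzero (c i))     ≤⟨ ∑-mono (λ i → nonzero-mono (supp i)) ⟩
  ∑ (λ i → nonzero (g i))     ≡⟨ wtv≡∑nonzero g ⟨
  wtv g                       ∎
  where open ≤-Reasoning

∑≤1⇒≤k : ∀ {k} (f : Fin k → ℕ) → (∀ i → f i ≤ 1) → ∑ f ≤ k
∑≤1⇒≤k {zero} f h = z≤n
∑≤1⇒≤k {suc k} f h = +-mono-≤ (h fz) (∑≤1⇒≤k (λ i → f (fs i)) (λ i → h (fs i)))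

∑≤1⇒≤k∸1 : ∀ {k} (f : Fin k → ℕ) j → (∀ i → f i ≤ 1) → f j ≡ 0 → ∑ f ≤ k ∸ 1
∑≤1⇒≤k∸1 {suc k} f fz h f0≡0 =
  ≤-trans (≤-reflexive (cong (_+ ∑ (λ i → f (fs i))) f0≡0)) (∑≤1⇒≤k (λ i → f (fs i)) (λ i → h (fs i)))
∑≤1⇒≤k∸1 {suc (suc k)} f (fs j) h fj≡0 = +-mono-≤ (h fz) (∑≤1⇒≤k∸1 (λ i → f (fs i)) j (λ i → h (fs i)) fj≡0)

wtv≤k : ∀ {k} (c : Fin k → ℕ) → wtv c ≤ k
wtv≤k c = ≤-trans (≤-reflexive (wtv≡∑nonzero c)) (∑≤1⇒≤k _ (λ i → nonzero≤1 (c i)))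

wtv≤k∸1 : ∀ {k} (c : Fin k → ℕ) j → c j ≡ 0 → wtv c ≤ k ∸ 1
wtv≤k∸1 c j cj≡0 = ≤-trans (≤-reflexive (wtv≡∑nonzero c))
                     (∑≤1⇒≤k∸1 (λ i → nonzero (c i)) j (λ i → nonzero≤1 (c i)) (cong nonzero cj≡0))

-- Any amount e ≤ ∑ x can be taken out of x (entrywise) using at most e nonzero entries:
-- fill the entries greedily from the left.
takeAmount : ∀ {k} (x : Fin k → ℕ) e → e ≤ ∑ x → ∃ λ g → (∀ i → g i ≤ x i) × ∑ g ≡ e × wtv g ≤ e
takeAmount {zero} x zero e≤ = (λ ()) , (λ ()) , refl , z≤n
takeAmount {suc k} x e e≤ with x fz ≤? e
... | yes x0≤e with takeAmount (λ i → x (fs i)) (e ∸ x fz) (≤-trans (∸-monoˡ-≤ (x fz) e≤) (≤-reflexive (m+n∸m≡n (x fz) _)))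
...   | g , g≤ , ∑g , wg = (x fz ∷ g) , (λ { fz → ≤-refl ; (fs i) → g≤ i }) ,
        trans (cong (x fz +_) ∑g) (m+[n∸m]≡n x0≤e) , ≤-trans (+-monoʳ-≤ (nonzero (x fz)) wg) (weight≤ (x fz) x0≤e)
  where
  weight≤ : ∀ a → a ≤ e → nonzero a + (e ∸ a) ≤ e
  weight≤ zero _ = ≤-refl
  weight≤ (suc a) a<e = ≤-trans (+-monoˡ-≤ (e ∸ suc a) (s≤s (z≤n {a}))) (≤-reflexive (m+[n∸m]≡n a<e))
takeAmount {suc k} x e e≤ | no x0≰e with takeAmount (λ i → x (fs i)) 0 z≤n
... | g , g≤ , ∑g , wg = (e ∷ g) , (λ { fz → <⇒≤ (≰⇒> x0≰e) ; (fs i) → g≤ i }) ,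
      trans (cong (e +_) ∑g) (+-identityʳ e) , ≤-trans (+-mono-≤ (nonzero≤ e) wg) (≤-reflexive (+-identityʳ e))

takeAmountAvoiding : ∀ {k} (x : Fin k → ℕ) j e → e ≤ ∑ x ∸ x j →
                     ∃ λ g → (∀ i → g i ≤ x i) × ∑ g ≡ e × wtv g ≤ e × g j ≡ 0
takeAmountAvoiding x j e e≤ with takeAmount (set j 0 x) e (≤-trans e≤ (≤-reflexive others))
  where
  others : ∑ x ∸ x j ≡ ∑ (set j 0 x)
  others = trans (cong (_∸ x j) (∑-split j x)) (m+n∸m≡n (x j) _)
... | g , g≤ , ∑g , wg = g , g≤x , ∑g , wg , n≤0⇒n≡0 (≤-trans (g≤ j) (≤-reflexive (set-self j 0 x)))
  where
  g≤x : ∀ i → g i ≤ x i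
  g≤x i with i FP.≟ j
  ... | yes refl = ≤-trans (g≤ i) (≤-trans (≤-reflexive (set-self j 0 x)) z≤n)
  ... | no i≢j = ≤-trans (g≤ i) (≤-reflexive (set-other j 0 x i i≢j))

argmin : ∀ {k} (x : Fin (suc k) → ℕ) → ∃ λ j → ∀ i → x j ≤ x i
argmin {zero} x = fz , λ { fz → ≤-refl }
argmin {suc k} x with argmin (λ i → x (fs i))
... | j , xj≤ with x fz ≤? x (fs j)
...   | yes le = fz , λ { fz → ≤-refl ; (fs i) → ≤-trans le (xj≤ i) }
...   | no nle = fs j , λ { fz → <⇒≤ (≰⇒> nle) ; (fs i) → xj≤ i }

firstOnes : ∀ {k} → ℕ → Fin k → ℕ
firstOnes j i = ⟦ toℕ i <ᵇ j ⟧

∑-firstOnes : ∀ {k} j → ∑ (λ (i : Fin k) → firstOnes j i) ≡ j ⊓ k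
∑-firstOnes {zero} zero = refl
∑-firstOnes {zero} (suc j) = refl
∑-firstOnes {suc k} zero = ∑-zero {suc k} (λ i → refl)
∑-firstOnes {suc k} (suc j) = cong suc (∑-firstOnes {k} j)

firstOnes-1 : ∀ {k} j (i : Fin k) → toℕ i < j → firstOnes j i ≡ 1
firstOnes-1 j i lt with toℕ i <ᵇ j in eq
... | true = refl
... | false = contradiction (<⇒<ᵇ lt) (subst T eq)

firstOnes-0 : ∀ {k} j (i : Fin k) → ¬ (toℕ i < j) → firstOnes j i ≡ 0
firstOnes-0 j i nlt with toℕ i <ᵇ j in eq
... | true = contradiction (<ᵇ⇒< (toℕ i) j (subst T (sym eq) tt)) nlt
... | false = refl

firstOnes≤1 : ∀ {k} j (i : Fin k) → firstOnes j i ≤ 1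
firstOnes≤1 j i with toℕ i <ᵇ j
... | true = ≤-refl
... | false = z≤n

wtv-firstOnes : ∀ {k} j (c : Fin k → ℕ) → j ≤ k → (∀ i → toℕ i < j → c i ≢ 0) → j ≤ wtv c
wtv-firstOnes {k} j c j≤k nz = begin
  j                                ≡⟨ trans (sym (m≤n⇒m⊓n≡m j≤k)) (sym (∑-firstOnes {k} j)) ⟩
  ∑ (λ (i : Fin k) → firstOnes j i) ≤⟨ ∑-mono pointwise ⟩
  ∑ (λ i → nonzero (c i))          ≡⟨ wtv≡∑nonzero c ⟨
  wtv c                            ∎
  where
  open ≤-Reasoning
  pointwise : ∀ i → firstOnes j i ≤ nonzero (c i)
  pointwise i with toℕ i <? j
  ... | yes lt = ≤-reflexive (trans (firstOnes-1 j i lt) (sym (nonzero-1 (nz i lt))))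
    where
    nonzero-1 : ∀ {x} → x ≢ 0 → nonzero x ≡ 1
    nonzero-1 {zero} x≢0 = contradiction refl x≢0
    nonzero-1 {suc x} _ = refl
  ... | no nlt = ≤-trans (≤-reflexive (firstOnes-0 j i nlt)) z≤n

wtv-01 : ∀ {k} (c : Fin k → ℕ) → (∀ i → c i ≤ 1) → wtv c ≡ ∑ c
wtv-01 c c≤1 = trans (wtv≡∑nonzero c) (∑-cong λ i → nonzero-01 (c i) (c≤1 i))
  where
  nonzero-01 : ∀ x → x ≤ 1 → nonzero x ≡ x
  nonzero-01 zero _ = refl
  nonzero-01 (suc zero) _ = refl
  nonzero-01 (suc (suc x)) (s≤s ())

-- Choosing how much to subtract from a digit sum S so that the new sum has residue τ modulo n,
-- where τ is at most the current (S + (n − 1)) mod n (the value φ shows at the minimal order).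
-- Besides 1 ≤ e ≤ min(S, n), a positive target allows the sharper bounds needed at level 0.
record Decrement (S n τ : ℕ) .{{_ : NonZero n}} : Set where
  field
    e : ℕ
    1≤e : 1 ≤ e
    e≤S : e ≤ S
    e≤n : e ≤ n
    residue : (S ∸ e) % n ≡ τ
    e≤n∸1 : 1 ≤ τ → e ≤ n ∸ 1
    e<S : 1 ≤ τ → e + 1 ≤ S
    e+n≤S : 1 ≤ τ → n < S → e + n ≤ S

decrement : ∀ S n τ .{{_ : NonZero n}} → S ≢ 0 → τ ≤ (S + (n ∸ 1)) % n → Decrement S n τ
decrement S n τ S≢0 τ≤ with S % n in S%n
... | zero = record
    { e = n ∸ τ
    ; 1≤e = m<n⇒0<n∸m τ<n
    ; e≤S = ≤-trans (m∸n≤m n τ) n≤S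
    ; e≤n = m∸n≤m n τ
    ; residue = residue
    ; e≤n∸1 = λ 1≤τ → ∸-monoʳ-≤ n 1≤τ
    ; e<S = λ 1≤τ → ≤-trans (≤-trans (+-monoˡ-≤ 1 (∸-monoʳ-≤ n 1≤τ)) (≤-reflexive (m∸n+n≡m (>-nonZero⁻¹ n)))) n≤S
    ; e+n≤S = λ 1≤τ n<S → ≤-trans (+-monoˡ-≤ n (≤-trans (∸-monoʳ-≤ n 1≤τ) (m∸n≤m n 1))) (m%n≡0⇒2n≤m S n S%n n<S)
    }
  where
  -- S is a nonzero multiple of n, so (S + (n − 1)) mod n = n − 1
  τ<n : τ < n
  τ<n = ≤-<-trans (≤-trans τ≤ (≤-reflexive (trans (sym (%-absorbˡ S (n ∸ 1) n))
          (trans (cong (λ z → (z + (n ∸ 1)) % n) S%n) (m<n⇒m%n≡m (n∸1<n n)))))) (n∸1<n n)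
  n≤S : n ≤ S
  n≤S = m%n≡0⇒n≤m S n S%n S≢0
  residue : (S ∸ (n ∸ τ)) % n ≡ τ
  residue = begin
    (S ∸ (n ∸ τ)) % n                    ≡⟨ cong (λ z → (z ∸ (n ∸ τ)) % n) S≡ ⟩
    ((n ∸ τ) + (τ + r) ∸ (n ∸ τ)) % n    ≡⟨ cong (_% n) (m+n∸m≡n (n ∸ τ) (τ + r)) ⟩
    (τ + r) % n                          ≡⟨ %-absorbʳ τ r n ⟨
    (τ + r % n) % n                      ≡⟨ cong (λ z → (τ + z) % n) (trans (m≤n⇒[n∸m]%m≡n%m n≤S) S%n) ⟩
    (τ + 0) % n                          ≡⟨ cong (_% n) (+-identityʳ τ) ⟩
    τ % n                                ≡⟨ m<n⇒m%n≡m τ<n ⟩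
    τ                                    ∎
    where
    open ≡-Reasoning
    r = S ∸ n
    S≡ : S ≡ (n ∸ τ) + (τ + r)
    S≡ = trans (sym (m+[n∸m]≡n n≤S)) (trans (cong (_+ r) (sym (m∸n+n≡m (<⇒≤ τ<n)))) (+-assoc (n ∸ τ) τ r))
... | suc σ = record
    { e = suc σ ∸ τ
    ; 1≤e = m<n⇒0<n∸m (s≤s τ≤σ)
    ; e≤S = ≤-trans (m∸n≤m (suc σ) τ) σ<S
    ; e≤n = ≤-trans (m∸n≤m (suc σ) τ) (<⇒≤ σ<n)
    ; residue = trans ([m∸d]%n≡m%n∸d S (suc σ ∸ τ) n (subst (suc σ ∸ τ ≤_) (sym S%n) (m∸n≤m (suc σ) τ)))
                  (trans (cong (_∸ (suc σ ∸ τ)) S%n) (m∸[m∸n]≡n (≤-trans τ≤σ (n≤1+n σ))))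
    ; e≤n∸1 = λ 1≤τ → ≤-trans (e≤σ 1≤τ) (<⇒≤∸1 (<-trans (n<1+n σ) σ<n))
    ; e<S = λ 1≤τ → ≤-trans (≤-trans (+-monoˡ-≤ 1 (e≤σ 1≤τ)) (≤-reflexive (+-comm σ 1))) σ<S
    ; e+n≤S = λ 1≤τ n<S → ≤-trans (+-monoˡ-≤ n (≤-trans (e≤σ 1≤τ) (n≤1+n σ)))
                            (subst (λ z → z + n ≤ S) S%n (m%n+n≤m S n (<⇒≤ n<S)))
    }
  where
  -- S has remainder 1 + σ, so (S + (n − 1)) mod n = σ
  σ<n : suc σ < n
  σ<n = subst (_< n) S%n (m%n<n S n)
  σ<S : suc σ ≤ S
  σ<S = subst (_≤ S) S%n (m%n≤m S n)
  τ≤σ : τ ≤ σ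
  τ≤σ = ≤-trans τ≤ (≤-reflexive (trans (sym (%-absorbˡ S (n ∸ 1) n))
          (trans (cong (λ z → (z + (n ∸ 1)) % n) S%n) ([1+v+[n∸1]]%n≡v σ n (<-trans (n<1+n σ) σ<n)))))
  e≤σ : 1 ≤ τ → suc σ ∸ τ ≤ σ
  e≤σ 1≤τ = ∸-monoʳ-≤ (suc σ) 1≤τ

module Radix (β : ℕ → ℕ) (hβ : ∀ L → 2 ≤ β L) where
  open Mixed β hβ public

  instance
    β-instance : ∀ {L} → NonZero (β L)
    β-instance {L} = β-nz L

  -- n %B L is n mod B_L (the part of n below level L), n /B L the part from level L on.
  _%B_ _/B_ : ℕ → ℕ → ℕ
  n %B L = _%_ n (B β L) {{B-nz L}}
  n /B L = _/_ n (B β L) {{B-nz L}}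
  infixl 7 _%B_ _/B_

  β≥1 : ∀ L → 1 ≤ β L
  β≥1 L = ≤-trans (s≤s z≤n) (hβ L)

  B≥1 : ∀ L → 1 ≤ B β L
  B≥1 zero = s≤s z≤n
  B≥1 (suc L) = *-mono-≤ (B≥1 L) (β≥1 L)

  B<B[1+L] : ∀ L → B β L < B β (suc L)
  B<B[1+L] L = begin-strict
    B β L             <⟨ m<m+n (B β L) (B≥1 L) ⟩
    B β L + B β L     ≡⟨ cong (B β L +_) (sym (+-identityʳ (B β L))) ⟩
    2 * B β L         ≡⟨ *-comm 2 (B β L) ⟩
    B β L * 2         ≤⟨ *-monoʳ-≤ (B β L) (hβ L) ⟩
    B β L * β L       ∎
    where open ≤-Reasoning

  B-mono : ∀ {L L'} → L ≤ L' → B β L ≤ B β L'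
  B-mono {L} le = go (≤⇒≤′ le)
    where
    go : ∀ {M} → L ≤′ M → B β L ≤ B β M
    go ≤′-refl = ≤-refl
    go (≤′-step {M} p) = ≤-trans (go p) (<⇒≤ (B<B[1+L] M))

  -- B_n grows at least like 2^n; in particular every n has no digits from level n on.
  n<B[n] : ∀ n → n < B β n
  n<B[n] zero = s≤s z≤n
  n<B[n] (suc n) = ≤-trans (s≤s (n<B[n] n)) (B<B[1+L] n)

  n<B[m+n] : ∀ m n → n < B β (m + n)
  n<B[m+n] m n = ≤-trans (n<B[n] n) (B-mono (m≤n+m n m))

  /B-suc : ∀ n L → n /B suc L ≡ n /B L / β L
  /B-suc n L = sym (m/n/o≡m/[n*o] n (B β L) (β L) {{B-nz L}} {{β-nz L}} {{B-nz (suc L)}})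

  digit<β : ∀ n L → digit n L < β L
  digit<β n L = m%n<n (n /B L) (β L)

  digit-decomposition : ∀ n L → n ≡ n %B L + (digit n L + n /B suc L * β L) * B β L
  digit-decomposition n L = begin
    n                                                  ≡⟨ m≡m%n+[m/n]*n n (B β L) {{B-nz L}} ⟩
    n %B L + n /B L * B β L                            ≡⟨ cong (λ t → n %B L + t * B β L) (m≡m%n+[m/n]*n (n /B L) (β L)) ⟩
    n %B L + (digit n L + n /B L / β L * β L) * B β L  ≡⟨ cong (λ t → n %B L + (digit n L + t * β L) * B β L) (/B-suc n L) ⟨
    n %B L + (digit n L + n /B suc L * β L) * B β L    ∎
    where open ≡-Reasoning

  module Assembled (r a h L : ℕ) (r< : r < B β L) (a< : a < β L) where
    n : ℕ
    n = r + (a + h * β L) * B β L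

    n/B : n /B L ≡ a + h * β L
    n/B = [r+kd]/d≡k r (a + h * β L) (B β L) {{B-nz L}} r<

    low : n %B L ≡ r
    low = [r+kd]%d≡r r (a + h * β L) (B β L) {{B-nz L}} r<

    digit-L : digit n L ≡ a
    digit-L = trans (cong (_% β L) n/B) ([r+kd]%d≡r a h (β L) a<)

    high : n /B suc L ≡ h
    high = trans (/B-suc n L) (trans (cong (_/ β L) n/B) ([r+kd]/d≡k a h (β L) a<))

  0%β : ∀ p → 0 % β p ≡ 0
  0%β p = m<n⇒m%n≡m (β≥1 p)

  [β∸1]%β : ∀ p → (β p ∸ 1) % β p ≡ β p ∸ 1
  [β∸1]%β p = m<n⇒m%n≡m (n∸1<n (β p))

  digit-zero : ∀ p → digit 0 p ≡ 0
  digit-zero p = trans (cong (_% β p) (m<n⇒m/n≡0 {{B-nz p}} (B≥1 p))) (0%β p)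

  digit-above : ∀ {n L p} → n < B β L → L ≤ p → digit n p ≡ 0
  digit-above {n} {L} {p} n< L≤p = trans (cong (_% β p) (m<n⇒m/n≡0 {{B-nz p}} (≤-trans n< (B-mono L≤p)))) (0%β p)

  digit-high : ∀ {n n' L p} → n /B L ≡ n' /B L → L ≤ p → digit n p ≡ digit n' p
  digit-high {n} {n'} {L} {p} eq le = cong (_% β p) (go (≤⇒≤′ le))
    where
    go : ∀ {M} → L ≤′ M → n /B M ≡ n' /B M
    go ≤′-refl = eq
    go (≤′-step {M} q) = trans (/B-suc n M) (trans (cong (_/ β M) (go q)) (sym (/B-suc n' M)))

  digit≡%B/B : ∀ n p → digit n p ≡ n %B suc p /B p
  digit≡%B/B n p = sym (trans (cong (_/B p) (%-congʳ {{B-nz (suc p)}} {{nz}} (*-comm (B β p) (β p))))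
                            (m%[n*o]/o≡m/o%n n (β p) (B β p) {{β-nz p}} {{B-nz p}} {{nz}}))
    where
    nz : NonZero (β p * B β p)
    nz = m*n≢0 (β p) (B β p) {{β-nz p}} {{B-nz p}}

  B∣B : ∀ {L L'} → L ≤ L' → B β L ∣ B β L'
  B∣B {L} le = go (≤⇒≤′ le)
    where
    go : ∀ {M} → L ≤′ M → B β L ∣ B β M
    go ≤′-refl = ∣-refl
    go (≤′-step {M} q) = ∣-trans (go q) (m∣m*n (β M))

  digit-low : ∀ {n n' L p} → n %B L ≡ n' %B L → p < L → digit n p ≡ digit n' p
  digit-low {n} {n'} {L} {p} eq p<L = begin
    digit n p             ≡⟨ digit≡%B/B n p ⟩
    n %B suc p /B p       ≡⟨ cong (_/B p) (%B-down n) ⟨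
    n %B L %B suc p /B p  ≡⟨ cong (λ t → t %B suc p /B p) eq ⟩
    n' %B L %B suc p /B p ≡⟨ cong (_/B p) (%B-down n') ⟩
    n' %B suc p /B p      ≡⟨ digit≡%B/B n' p ⟨
    digit n' p            ∎
    where
    open ≡-Reasoning
    %B-down : ∀ m → m %B L %B suc p ≡ m %B suc p
    %B-down m = m∣n⇒o%n%m≡o%m (B β (suc p)) (B β L) m {{B-nz (suc p)}} {{B-nz L}} (B∣B p<L)

  digit-%B : ∀ n L p → p < L → digit n p ≡ digit (n %B L) p
  digit-%B n L p p<L = digit-low (sym (m%n%n≡m%n n (B β L) {{B-nz L}})) p<L

  %B-suc : ∀ n L → n %B suc L ≡ n %B L + digit n L * B β L
  %B-suc n L = trans (cong (_%B suc L) split) ([r+kd]%d≡r _ h (B β (suc L)) {{B-nz (suc L)}} lt)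
    where
    r = n %B L
    d = digit n L
    h = n /B suc L
    regroup : ∀ r d h b c → r + (d + h * c) * b ≡ (r + d * b) + h * (b * c)
    regroup = solve-∀
    split : n ≡ (r + d * B β L) + h * B β (suc L)
    split = trans (digit-decomposition n L) (regroup r d h (B β L) (β L))
    lt : r + d * B β L < B β (suc L)
    lt = ≤-trans (+-monoˡ-< (d * B β L) (m%n<n n (B β L) {{B-nz L}}))
           (≤-trans (*-monoˡ-≤ (B β L) (digit<β n L)) (≤-reflexive (*-comm (β L) (B β L))))

  digit-injective : ∀ {a b} → (∀ p → digit a p ≡ digit b p) → a ≡ b
  digit-injective {a} {b} same = begin
    a                 ≡⟨ m<n⇒m%n≡m {{B-nz (a + b)}} (≤-trans (n<B[n] a) (B-mono (m≤m+n a b))) ⟨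
    a %B (a + b)      ≡⟨ lowParts (a + b) ⟩
    b %B (a + b)      ≡⟨ m<n⇒m%n≡m {{B-nz (a + b)}} (n<B[m+n] a b) ⟩
    b                 ∎
    where
    open ≡-Reasoning
    lowParts : ∀ L → a %B L ≡ b %B L
    lowParts zero = trans (n%1≡0 a) (sym (n%1≡0 b))
    lowParts (suc L) = trans (%B-suc a L) (trans (cong₂ _+_ (lowParts L) (cong (_* B β L) (same L))) (sym (%B-suc b L)))

  fromDigits : ℕ → (ℕ → ℕ) → ℕ
  fromDigits L g = sumTo L (λ p → g p * B β p)

  fromDigits<B : ∀ L g → (∀ p → p < L → g p < β p) → fromDigits L g < B β L
  fromDigits<B zero g g< = s≤s z≤n
  fromDigits<B (suc L) g g< =
    ≤-trans (+-monoˡ-< (g L * B β L) (fromDigits<B L g (λ p p< → g< p (≤-trans p< (n≤1+n L)))))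
      (≤-trans (*-monoˡ-≤ (B β L) (g< L ≤-refl)) (≤-reflexive (*-comm (β L) (B β L))))

  -- fromDigits (suc L) g is fromDigits L g with the digit g L assembled at level L.
  fromDigits-suc : ∀ L g → fromDigits (suc L) g ≡ fromDigits L g + (g L + 0 * β L) * B β L
  fromDigits-suc L g = cong (λ t → fromDigits L g + t * B β L) (sym (+-identityʳ (g L)))

  digit-fromDigits : ∀ L g → (∀ p → p < L → g p < β p) → ∀ p → p < L → digit (fromDigits L g) p ≡ g p
  digit-fromDigits (suc L) g g< p p<1+L = cases (m≤n⇒m<n∨m≡n (≤-pred p<1+L))
    where
    g<' : ∀ p → p < L → g p < β p
    g<' p p< = g< p (≤-trans p< (n≤1+n L))
    r< : fromDigits L g < B β L
    r< = fromDigits<B L g g<'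
    lowEq : fromDigits (suc L) g %B L ≡ fromDigits L g %B L
    lowEq = trans (cong (_%B L) (fromDigits-suc L g))
              (trans (Assembled.low _ (g L) 0 L r< (g< L ≤-refl)) (sym (m<n⇒m%n≡m {{B-nz L}} r<)))
    atL : digit (fromDigits (suc L) g) L ≡ g L
    atL = trans (cong (λ n → digit n L) (fromDigits-suc L g)) (Assembled.digit-L _ (g L) 0 L r< (g< L ≤-refl))
    cases : p < L ⊎ p ≡ L → digit (fromDigits (suc L) g) p ≡ g p
    cases (inj₁ p<L) = trans (digit-low lowEq p<L) (digit-fromDigits L g g<' p p<L)
    cases (inj₂ p≡L) = subst (λ q → digit (fromDigits (suc L) g) q ≡ g q) (sym p≡L) atL

  digit-⊕ : ∀ a b p → digit (a ⊕ b) p ≡ (digit a p + digit b p) % β p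
  digit-⊕ a b p with p <? a + b
  ... | yes p< = digit-fromDigits (a + b) sumDigits (λ q _ → m%n<n _ (β q)) p p<
    where sumDigits = λ L → (digit a L + digit b L) % β L
  ... | no p≮ = begin
      digit (a ⊕ b) p                      ≡⟨ digit-above (fromDigits<B (a + b) sumDigits (λ q _ → m%n<n _ (β q))) a+b≤p ⟩
      0                                    ≡⟨ 0%β p ⟨
      (0 + 0) % β p                        ≡⟨ cong₂ (λ x y → (x + y) % β p) (digit-above a< a+b≤p) (digit-above (n<B[m+n] a b) a+b≤p) ⟨
      (digit a p + digit b p) % β p        ∎
    where
    open ≡-Reasoning
    sumDigits = λ L → (digit a L + digit b L) % β L
    a+b≤p = ≮⇒≥ p≮
    a< : a < B β (a + b)
    a< = ≤-trans (n<B[n] a) (B-mono (m≤m+n a b))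

  B∸1≡fromDigits : ∀ L → fromDigits L (λ p → β p ∸ 1) ≡ B β L ∸ 1
  B∸1≡fromDigits zero = refl
  B∸1≡fromDigits (suc L) = trans (cong (_+ (β L ∸ 1) * B β L) (B∸1≡fromDigits L)) (pred-product (B≥1 L) (β≥1 L))
    where
    pred-product : ∀ {b c} → 1 ≤ b → 1 ≤ c → (b ∸ 1) + (c ∸ 1) * b ≡ b * c ∸ 1
    pred-product {suc b} {suc c} _ _ = identity b c
      where
      identity : ∀ b c → b + c * suc b ≡ c + b * suc c
      identity = solve-∀

  -- The digits of B_{m+1} − 1, the number added to the digit sum in φ when mord X = m.
  ones : ℕ → ℕ → ℕ
  ones m p = digit (B β (m + 1) ∸ 1) p

  ones-≤ : ∀ {m p} → p ≤ m → ones m p ≡ β p ∸ 1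
  ones-≤ {m} {p} p≤m = trans (cong (λ n → digit n p) (sym (B∸1≡fromDigits (m + 1))))
                         (digit-fromDigits (m + 1) (λ p → β p ∸ 1) (λ q _ → n∸1<n (β q)) p
                           (≤-trans (s≤s p≤m) (≤-reflexive (+-comm 1 m))))

  ones-> : ∀ {m p} → m < p → ones m p ≡ 0
  ones-> {m} {p} m<p = digit-above (n∸1<n (B β (m + 1)) {{B-nz (m + 1)}}) (≤-trans (≤-reflexive (+-comm m 1)) m<p)

  digitSum : ∀ {k} → Vector ℕ k → ℕ → ℕ
  digitSum X p = ∑ (λ i → digit (X i) p)

  digit-⨁ : ∀ {k} (X : Vector ℕ k) p → digit (foldr _⊕_ 0 X) p ≡ digitSum X p % β p
  digit-⨁ {zero} X p = trans (digit-zero p) (sym (0%β p))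
  digit-⨁ {suc k} X p = begin
    digit (X fz ⊕ foldr _⊕_ 0 (λ i → X (fs i))) p               ≡⟨ digit-⊕ (X fz) _ p ⟩
    (digit (X fz) p + digit (foldr _⊕_ 0 (λ i → X (fs i))) p) % β p
                                                               ≡⟨ cong (λ t → (digit (X fz) p + t) % β p) (digit-⨁ (λ i → X (fs i)) p) ⟩
    (digit (X fz) p + digitSum (λ i → X (fs i)) p % β p) % β p   ≡⟨ %-absorbʳ (digit (X fz) p) _ (β p) ⟩
    digitSum X p % β p                                          ∎
    where open ≡-Reasoning

  digit-φ : ∀ {k} (X : Vector ℕ k) {m} → mord X ≡ just m → ∀ p → digit (φ k X) p ≡ (digitSum X p + ones m p) % β p
  digit-φ X {m} mordX p = begin
    digit (φ _ X) p                                          ≡⟨ cong (λ n → digit n p) (φ≡ X mordX) ⟩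
    digit (foldr _⊕_ 0 X ⊕ (B β (m + 1) ∸ 1)) p              ≡⟨ digit-⊕ _ _ p ⟩
    (digit (foldr _⊕_ 0 X) p + ones m p) % β p               ≡⟨ cong (λ t → (t + ones m p) % β p) (digit-⨁ X p) ⟩
    (digitSum X p % β p + ones m p) % β p                    ≡⟨ %-absorbˡ (digitSum X p) (ones m p) (β p) ⟩
    (digitSum X p + ones m p) % β p                          ∎
    where
    open ≡-Reasoning
    φ≡ : ∀ {k} (X : Vector ℕ k) {m} → mord X ≡ just m → φ k X ≡ foldr _⊕_ 0 X ⊕ (B β (m + 1) ∸ 1)
    φ≡ X eq with mord X
    φ≡ X refl | just m = refl

  digit-φ-above : ∀ {k} (X : Vector ℕ k) {m} → mord X ≡ just m → ∀ p → m < p → digit (φ k X) p ≡ digitSum X p % β p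
  digit-φ-above X mordX p m<p =
    trans (digit-φ X mordX p) (cong (_% β p) (trans (cong (digitSum X p +_) (ones-> m<p)) (+-identityʳ _)))

  digit-φ-below : ∀ {k} (X : Vector ℕ k) {m} → mord X ≡ just m → ∀ p → p ≤ m →
                  digit (φ k X) p ≡ (digitSum X p + (β p ∸ 1)) % β p
  digit-φ-below X mordX p p≤m = trans (digit-φ X mordX p) (cong (λ t → (digitSum X p + t) % β p) (ones-≤ p≤m))

  ZeroBelow : ℕ → ℕ → Set
  ZeroBelow t n = ∀ p → p < t → digit n p ≡ 0

  ZeroBelow-zero : ∀ t → ZeroBelow t 0
  ZeroBelow-zero t p _ = digit-zero p

  ZeroBelow-mono : ∀ {t t' n} → t ≤ t' → ZeroBelow t' n → ZeroBelow t n
  ZeroBelow-mono t≤t' z p p< = z p (≤-trans p< t≤t')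

  %B≡0⇒ZeroBelow : ∀ {t n} → n %B t ≡ 0 → ZeroBelow t n
  %B≡0⇒ZeroBelow {t} {n} eq p p< = trans (digit-%B n t p p<) (trans (cong (λ m → digit m p) eq) (digit-zero p))

  ZeroBelow⇒%B≡0 : ∀ {t n} → ZeroBelow t n → n %B t ≡ 0
  ZeroBelow⇒%B≡0 {t} {n} z = digit-injective same
    where
    same : ∀ p → digit (n %B t) p ≡ digit 0 p
    same p with p <? t
    ... | yes p< = trans (sym (digit-%B n t p p<)) (trans (z p p<) (sym (digit-zero p)))
    ... | no p≮ = trans (digit-above (m%n<n n (B β t) {{B-nz t}}) (≮⇒≥ p≮)) (sym (digit-zero p))

  ZeroBelow⇒B∣ : ∀ {t n} → ZeroBelow t n → B β t ∣ n
  ZeroBelow⇒B∣ {t} {n} z = m%n≡0⇒n∣m n (B β t) {{B-nz t}} (ZeroBelow⇒%B≡0 z)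

  lowestDigit : ∀ n → n ≢ 0 → ∃ λ t → digit n t ≢ 0 × ZeroBelow t n
  lowestDigit n n≢0 with least (λ p → digit n p ≢ 0) (λ p → ¬? (digit n p ≟ 0)) n
  ... | inj₁ (t , _ , dt≢0 , below) = t , dt≢0 , λ p p< → decidable-stable (digit n p ≟ 0) (below p p<)
  ... | inj₂ none = contradiction (digit-injective allZero) n≢0
    where
    allZero : ∀ p → digit n p ≡ digit 0 p
    allZero p with p <? n
    ... | yes p< = trans (decidable-stable (digit n p ≟ 0) (none p p<)) (sym (digit-zero p))
    ... | no p≮ = trans (digit-above (n<B[n] n) (≮⇒≥ p≮)) (sym (digit-zero p))

  ord≡ : ∀ {n t} → digit n t ≢ 0 → ZeroBelow t n → ord n ≡ just t
  ord≡ {n} {t} dt≢0 z with t <? n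
  ... | no t≮n = contradiction (digit-above (n<B[n] n) (≮⇒≥ t≮n)) dt≢0
  ord≡ {suc n} {t} dt≢0 z | yes t<n =
    cong just (search-least _ (suc n) t t<n (nonzero-true dt≢0) (λ p p< → cong (λ d → not (d ≡ᵇ 0)) (z p p<)))
    where
    nonzero-true : ∀ {d} → d ≢ 0 → not (d ≡ᵇ 0) ≡ true
    nonzero-true {zero} d≢0 = contradiction refl d≢0
    nonzero-true {suc d} _ = refl

  ord≡just⇒ : ∀ {n t} → ord n ≡ just t → digit n t ≢ 0 × ZeroBelow t n
  ord≡just⇒ {suc n} ordn with lowestDigit (suc n) (λ ())
  ... | t , dt≢0 , z with trans (sym (ord≡ dt≢0 z)) ordn
  ... | refl = dt≢0 , z

  ord≡nothing⇒ : ∀ {n} → ord n ≡ nothing → n ≡ 0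
  ord≡nothing⇒ {zero} _ = refl

  IsMord : ∀ {k} → Vector ℕ k → ℕ → Set
  IsMord X t = (∀ i → ZeroBelow t (X i)) × (∃ λ i → digit (X i) t ≢ 0)

  IsMord-unique : ∀ {k} {X : Vector ℕ k} {t t'} → IsMord X t → IsMord X t' → t ≡ t'
  IsMord-unique {t = t} {t'} (z , i , dt≢0) (z' , i' , dt'≢0) with <-cmp t t'
  ... | tri< t<t' _ _ = contradiction (z' i t t<t') dt≢0
  ... | tri≈ _ t≡t' _ = t≡t'
  ... | tri> _ _ t'<t = contradiction (z i' t' t'<t) dt'≢0

  IsMord-head : ∀ {k} (X : Vector ℕ (suc k)) {a} → ord (X fz) ≡ just a → (∀ i → ZeroBelow a (X (fs i))) → IsMord X a
  IsMord-head X ordX0 zTail = (λ { fz → proj₂ (ord≡just⇒ ordX0) ; (fs i) → zTail i }) , fz , proj₁ (ord≡just⇒ ordX0)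

  IsMord-tail : ∀ {k} (X : Vector ℕ (suc k)) {b} → ZeroBelow b (X fz) → IsMord (λ i → X (fs i)) b → IsMord X b
  IsMord-tail X zHead (zTail , i , dbi≢0) = (λ { fz → zHead ; (fs i) → zTail i }) , fs i , dbi≢0

  mord≡nothing⇒ : ∀ {k} (X : Vector ℕ k) → mord X ≡ nothing → ∀ i → X i ≡ 0
  mord≡nothing⇒ {suc k} X eq with ord (X fz) in ordX0 | mord (λ i → X (fs i)) in mordTail | eq
  ... | nothing | nothing | _ = λ { fz → ord≡nothing⇒ ordX0 ; (fs i) → mord≡nothing⇒ (λ i → X (fs i)) mordTail i }
  ... | nothing | just _ | ()
  ... | just _ | nothing | ()
  ... | just _ | just _ | ()

  mord≡just⇒ : ∀ {k} (X : Vector ℕ k) {t} → mord X ≡ just t → IsMord X t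
  mord≡just⇒ {suc k} X eq with ord (X fz) in ordX0 | mord (λ i → X (fs i)) in mordTail
  ... | nothing | just b with refl ← eq =
    IsMord-tail X (subst (ZeroBelow b) (sym (ord≡nothing⇒ ordX0)) (ZeroBelow-zero b)) (mord≡just⇒ _ mordTail)
  ... | just a | nothing with refl ← eq =
    IsMord-head X ordX0 (λ i → subst (ZeroBelow a) (sym (mord≡nothing⇒ _ mordTail i)) (ZeroBelow-zero a))
  ... | just a | just b with refl ← eq with ≤-total a b
  ...   | inj₁ a≤b = subst (IsMord X) (sym (m≤n⇒m⊓n≡m a≤b))
                       (IsMord-head X ordX0 (λ i → ZeroBelow-mono a≤b (proj₁ (mord≡just⇒ _ mordTail) i)))
  ...   | inj₂ b≤a = subst (IsMord X) (sym (m≥n⇒m⊓n≡n b≤a))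
                       (IsMord-tail X (ZeroBelow-mono b≤a (proj₂ (ord≡just⇒ ordX0))) (mord≡just⇒ _ mordTail))

  IsMord⇒mord≡ : ∀ {k} (X : Vector ℕ k) {t} → IsMord X t → mord X ≡ just t
  IsMord⇒mord≡ X {t} isMord@(_ , i , dti≢0) with mord X in mordX
  ... | nothing = contradiction (trans (cong (λ n → digit n t) (mord≡nothing⇒ X mordX i)) (digit-zero t)) dti≢0
  ... | just t' = cong just (IsMord-unique (mord≡just⇒ X mordX) isMord)

  mord-finite : ∀ {k} (X : Vector ℕ k) → InPmis X → ∃ λ m → mord X ≡ just m
  mord-finite X (i , Xi≢0) with mord X in mordX
  ... | nothing = contradiction (mord≡nothing⇒ X mordX i) Xi≢0
  ... | just m = m , refl

  +ZeroBelow-%B : ∀ {q y c} → ZeroBelow q c → (y + c) %B q ≡ y %B q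
  +ZeroBelow-%B {q} {y} z = %-remove-+ʳ y {{B-nz q}} (ZeroBelow⇒B∣ z)

  +ZeroBelow-digit : ∀ {q y c} → ZeroBelow q c → digit (y + c) q ≡ (digit y q + digit c q) % β q
  +ZeroBelow-digit {q} {y} {c} z = trans (cong (_% β q) (+-distrib-/-∣ʳ y {{B-nz q}} (ZeroBelow⇒B∣ z)))
                                          (%-distribˡ-+ (y /B q) (c /B q) (β q))

  Critical : ∀ {k} → Vector ℕ k → Set
  Critical c = ∃ λ q → (∀ i → ZeroBelow q (c i)) × (digitSum c q % β q ≢ 0)

  IsMord-transfer : ∀ {k} {X Y : Vector ℕ k} {q t} → (∀ i p → p < q → digit (X i) p ≡ digit (Y i) p) →
                    t < q → IsMord X t → IsMord Y t
  IsMord-transfer same t<q (z , i , dti≢0) =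
    (λ j p p< → trans (sym (same j p (<-trans p< t<q))) (z j p p<)) , i , λ dY≡0 → dti≢0 (trans (same i _ t<q) dY≡0)

  ones-agree : ∀ {k} (X Y : Vector ℕ k) {q mX mY} → (∀ i p → p < q → digit (X i) p ≡ digit (Y i) p) →
               mord X ≡ just mX → mord Y ≡ just mY → ones mX q ≡ ones mY q
  ones-agree X Y {q} {mX} {mY} same mordX mordY with q ≤? mX | q ≤? mY
  ... | yes q≤mX | yes q≤mY = trans (ones-≤ q≤mX) (sym (ones-≤ q≤mY))
  ... | yes q≤mX | no q≰mY = contradiction (subst (q ≤_) mX≡mY q≤mX) (<⇒≱ (≰⇒> q≰mY))
    where
    mX≡mY : mX ≡ mY
    mX≡mY = IsMord-unique (mord≡just⇒ X mordX)
              (IsMord-transfer (λ i p p< → sym (same i p p<)) (≰⇒> q≰mY) (mord≡just⇒ Y mordY))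
  ... | no q≰mX | _ = cong (λ t → ones t q)
                        (IsMord-unique (IsMord-transfer same (≰⇒> q≰mX) (mord≡just⇒ X mordX)) (mord≡just⇒ Y mordY))

  -- A critical move always changes the value of φ: at the critical level q the digit of φ
  -- shifts by the (nonzero mod β_q) digit sum of the move.
  critical-changes-φ : ∀ {k} (X Y c : Vector ℕ k) → InPmis X → InPmis Y → (∀ i → X i ≡ Y i + c i) →
                       Critical c → φ k X ≢ φ k Y
  critical-changes-φ {k} X Y c X∈P Y∈P X≡Y+c (q , zc , sumc≢0) φX≡φY =
    sumc≢0 ([a+b]%n≡a%n⇒b%n≡0 (digitSum Y q + ones mY q) (digitSum c q) (β q) shifted)
    where
    mX = proj₁ (mord-finite X X∈P)
    mordX = proj₂ (mord-finite X X∈P)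
    mY = proj₁ (mord-finite Y Y∈P)
    mordY = proj₂ (mord-finite Y Y∈P)
    sameBelow : ∀ i p → p < q → digit (X i) p ≡ digit (Y i) p
    sameBelow i p p< = trans (cong (λ n → digit n p) (X≡Y+c i)) (digit-low (+ZeroBelow-%B (zc i)) p<)
    sumAt-q : digitSum X q % β q ≡ (digitSum Y q + digitSum c q) % β q
    sumAt-q = begin
      digitSum X q % β q                                              ≡⟨ cong (_% β q) (∑-cong (λ i → trans (cong (λ n → digit n q) (X≡Y+c i)) (+ZeroBelow-digit (zc i)))) ⟩
      ∑ (λ i → (digit (Y i) q + digit (c i) q) % β q) % β q           ≡⟨ ∑-% (λ i → digit (Y i) q + digit (c i) q) (β q) ⟩
      ∑ (λ i → digit (Y i) q + digit (c i) q) % β q                   ≡⟨ cong (_% β q) (∑-+ (λ i → digit (Y i) q) (λ i → digit (c i) q)) ⟩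
      (digitSum Y q + digitSum c q) % β q                             ∎
      where open ≡-Reasoning
    sY = digitSum Y q
    sc = digitSum c q
    e = ones mY q
    shifted : (sY + e + sc) % β q ≡ (sY + e) % β q
    shifted = begin
      (sY + e + sc) % β q                  ≡⟨ cong (_% β q) (xy∙z≈xz∙y sY e sc) ⟩
      (sY + sc + e) % β q                  ≡⟨ %-absorbˡ (sY + sc) e (β q) ⟨
      ((sY + sc) % β q + e) % β q          ≡⟨ cong (λ t → (t + e) % β q) sumAt-q ⟨
      (digitSum X q % β q + e) % β q       ≡⟨ %-absorbˡ (digitSum X q) e (β q) ⟩
      (digitSum X q + e) % β q             ≡⟨ cong (λ t → (digitSum X q + t) % β q) (ones-agree X Y sameBelow mordX mordY) ⟨
      (digitSum X q + ones mX q) % β q     ≡⟨ digit-φ X mordX q ⟨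
      digit (φ k X) q                      ≡⟨ cong (λ n → digit n q) φX≡φY ⟩
      digit (φ k Y) q                      ≡⟨ digit-φ Y mordY q ⟩
      (sY + e) % β q                       ∎
      where open ≡-Reasoning

  Reachable : ∀ {k} → ℕ → Vector ℕ k → ℕ → Set
  Reachable {k} w X v = ∃ λ Y → InPmis Y × (∀ i → Y i ≤ X i) × φ k Y ≡ v ×
                          Critical (λ i → X i ∸ Y i) × wtv (λ i → X i ∸ Y i) ≤ w

  IsMord⇒InPmis : ∀ {k} {Y : Vector ℕ k} {t} → IsMord Y t → InPmis Y
  IsMord⇒InPmis {t = t} (_ , i , dti≢0) = i , λ Yi≡0 → dti≢0 (trans (cong (λ n → digit n t) Yi≡0) (digit-zero t))

  φ≡-byDigits : ∀ {k} (Y : Vector ℕ k) {t} v → IsMord Y t →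
                (∀ p → (digitSum Y p + ones t p) % β p ≡ digit v p) → φ k Y ≡ v
  φ≡-byDigits Y v isMord digits = digit-injective λ p → trans (digit-φ Y (IsMord⇒mord≡ Y isMord) p) (digits p)

  IsMord-byDigitSums : ∀ {k} (Y : Vector ℕ k) t → (∀ p → p < t → digitSum Y p ≡ 0) → digitSum Y t ≢ 0 → IsMord Y t
  IsMord-byDigitSums Y t below at =
    (λ i p p< → ∑≡0⇒≡0 (λ i → digit (Y i) p) (below p p<) i) , ∑≢0⇒∃≢0 (λ i → digit (Y i) t) at

  othersSum : ∀ {k} → Vector ℕ k → Fin k → ℕ → ℕ
  othersSum X i0 p = ∑ (set i0 0 (λ i → digit (X i) p))

  -- The candidate option Y: it agrees with X above level ℓ, has the digits a ≤ x at level ℓ,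
  -- and agrees with X below ℓ except that its i0-th component gets the low part R.
  module Candidate {k} (X : Vector ℕ k) (ℓ : ℕ) (a : Fin k → ℕ) (i0 : Fin k) (R : ℕ) (R< : R < B β ℓ)
                   (a≤ : ∀ i → a i ≤ digit (X i) ℓ) where
    x : Fin k → ℕ
    x i = digit (X i) ℓ

    low : Fin k → ℕ
    low = set i0 R (λ i → X i %B ℓ)

    low-other : ∀ i → i ≢ i0 → low i ≡ X i %B ℓ
    low-other i i≢i0 = set-other i0 R _ i i≢i0

    low< : ∀ i → low i < B β ℓ
    low< i with i FP.≟ i0
    ... | yes refl = subst (_< B β ℓ) (sym (set-self i0 R _)) R<
    ... | no i≢i0 = subst (_< B β ℓ) (sym (low-other i i≢i0)) (m%n<n (X i) (B β ℓ) {{B-nz ℓ}})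

    high : Fin k → ℕ
    high i = X i /B suc ℓ

    Y : Vector ℕ k
    Y i = low i + (a i + high i * β ℓ) * B β ℓ

    a< : ∀ i → a i < β ℓ
    a< i = ≤-<-trans (a≤ i) (digit<β (X i) ℓ)

    module Yᵢ (i : Fin k) = Assembled (low i) (a i) (high i) ℓ (low< i) (a< i)

    digit-Y-below : ∀ i p → p < ℓ → digit (Y i) p ≡ digit (low i) p
    digit-Y-below i p p< = digit-low (trans (Yᵢ.low i) (sym (m<n⇒m%n≡m {{B-nz ℓ}} (low< i)))) p<

    digitSum-Y-above : ∀ p → ℓ < p → digitSum Y p ≡ digitSum X p
    digitSum-Y-above p ℓ<p = ∑-cong (λ i → digit-high (Yᵢ.high i) ℓ<p)

    digitSum-Y-at : digitSum Y ℓ ≡ ∑ a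
    digitSum-Y-at = ∑-cong Yᵢ.digit-L

    digitSum-Y-below : ∀ p → p < ℓ → digitSum Y p ≡ digit R p + othersSum X i0 p
    digitSum-Y-below p p< = trans (∑-cong pointwise) (∑-set i0 (digit R p) (λ i → digit (X i) p))
      where
      pointwise : ∀ i → digit (Y i) p ≡ set i0 (digit R p) (λ i → digit (X i) p) i
      pointwise i with i FP.≟ i0
      ... | yes refl = trans (digit-Y-below i p p<) (trans (cong (λ n → digit n p) (set-self i0 R _)) (sym (set-self i0 _ _)))
      ... | no i≢i0 = trans (digit-Y-below i p p<) (trans (cong (λ n → digit n p) (low-other i i≢i0))
                        (trans (sym (digit-%B (X i) ℓ p p<)) (sym (set-other i0 _ _ i i≢i0))))

    -- Y ≤ X: for i ≠ i0 since a ≤ x; for i0 if a_{i0} < x_{i0} or R is at most the old low part.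
    Y≤X : Y i0 ≤ X i0 → ∀ i → Y i ≤ X i
    Y≤X Yi0≤ i with i FP.≟ i0
    ... | yes refl = Yi0≤
    ... | no i≢i0 = begin
      low i + (a i + high i * β ℓ) * B β ℓ          ≤⟨ +-mono-≤ (≤-reflexive (low-other i i≢i0)) (*-monoˡ-≤ (B β ℓ) (+-monoˡ-≤ _ (a≤ i))) ⟩
      X i %B ℓ + (x i + high i * β ℓ) * B β ℓ       ≡⟨ digit-decomposition (X i) ℓ ⟨
      X i                                          ∎
      where open ≤-Reasoning

    Yi0≤Xi0-lower : a i0 < x i0 → Y i0 ≤ X i0
    Yi0≤Xi0-lower a<x = begin
      low i0 + (a i0 + high i0 * β ℓ) * B β ℓ       ≤⟨ +-monoˡ-≤ _ (<⇒≤ (low< i0)) ⟩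
      B β ℓ + (a i0 + high i0 * β ℓ) * B β ℓ        ≤⟨ *-monoˡ-≤ (B β ℓ) (+-monoˡ-≤ (high i0 * β ℓ) a<x) ⟩
      (x i0 + high i0 * β ℓ) * B β ℓ                ≤⟨ m≤n+m _ _ ⟩
      X i0 %B ℓ + (x i0 + high i0 * β ℓ) * B β ℓ    ≡⟨ digit-decomposition (X i0) ℓ ⟨
      X i0                                         ∎
      where open ≤-Reasoning

    Yi0≤Xi0-R0 : R ≡ 0 → Y i0 ≤ X i0
    Yi0≤Xi0-R0 R≡0 = begin
      low i0 + (a i0 + high i0 * β ℓ) * B β ℓ       ≤⟨ +-mono-≤ (≤-trans (≤-reflexive (trans (set-self i0 R _) R≡0)) z≤n)
                                                                 (*-monoˡ-≤ (B β ℓ) (+-monoˡ-≤ _ (a≤ i0))) ⟩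
      X i0 %B ℓ + (x i0 + high i0 * β ℓ) * B β ℓ    ≡⟨ digit-decomposition (X i0) ℓ ⟨
      X i0                                         ∎
      where open ≤-Reasoning

    c : Vector ℕ k
    c i = X i ∸ Y i

    c≡ : ∀ i → low i ≡ X i %B ℓ → c i ≡ (x i ∸ a i) * B β ℓ
    c≡ i sameLow = begin
      X i ∸ Y i                                                  ≡⟨ cong₂ _∸_ (digit-decomposition (X i) ℓ) (cong (_+ (a i + h * β ℓ) * B β ℓ) sameLow) ⟩
      (r + (x i + h * β ℓ) * B β ℓ) ∸ (r + (a i + h * β ℓ) * B β ℓ) ≡⟨ [m+n]∸[m+o]≡n∸o r _ _ ⟩
      (x i + h * β ℓ) * B β ℓ ∸ (a i + h * β ℓ) * B β ℓ          ≡⟨ *-distribʳ-∸ (B β ℓ) (x i + h * β ℓ) (a i + h * β ℓ) ⟨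
      ((x i + h * β ℓ) ∸ (a i + h * β ℓ)) * B β ℓ                ≡⟨ cong (_* B β ℓ) (trans (cong₂ _∸_ (+-comm (x i) _) (+-comm (a i) _)) ([m+n]∸[m+o]≡n∸o (h * β ℓ) (x i) (a i))) ⟩
      (x i ∸ a i) * B β ℓ                                        ∎
      where
      open ≡-Reasoning
      r = X i %B ℓ
      h = high i

    c-ZeroBelow : ∀ i → low i ≡ X i %B ℓ → ZeroBelow ℓ (c i)
    c-ZeroBelow i sameLow = %B≡0⇒ZeroBelow (trans (cong (_%B ℓ) (c≡ i sameLow)) (m*n%n≡0 (x i ∸ a i) (B β ℓ) {{B-nz ℓ}}))

    c-digit : ∀ i → low i ≡ X i %B ℓ → digit (c i) ℓ ≡ x i ∸ a i
    c-digit i sameLow = trans (cong (λ n → digit n ℓ) (trans (c≡ i sameLow) (cong (_* B β ℓ) (sym (+-identityʳ (x i ∸ a i))))))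
                          (Assembled.digit-L 0 (x i ∸ a i) 0 ℓ (B≥1 ℓ) (≤-<-trans (m∸n≤m (x i) (a i)) (digit<β (X i) ℓ)))

    critical-at-ℓ : (∀ i → low i ≡ X i %B ℓ) → ∑ (λ i → x i ∸ a i) % β ℓ ≢ 0 → Critical c
    critical-at-ℓ sameLow sum≢0 =
      ℓ , (λ i → c-ZeroBelow i (sameLow i)) , λ e → sum≢0 (trans (cong (_% β ℓ) (sym (∑-cong (λ i → c-digit i (sameLow i))))) e)

    -- Otherwise the i0-th component of the move has a nonzero part below ℓ ...
    c-i0-low≢0 : R ≢ X i0 %B ℓ → Y i0 ≤ X i0 → c i0 %B ℓ ≢ 0
    c-i0-low≢0 R≢ Yi0≤ ci0%B≡0 = R≢ (begin
      R                  ≡⟨ set-self i0 R (λ i → X i %B ℓ) ⟨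
      low i0             ≡⟨ Yᵢ.low i0 ⟨
      Y i0 %B ℓ          ≡⟨ +ZeroBelow-%B {ℓ} {Y i0} (%B≡0⇒ZeroBelow {ℓ} {c i0} ci0%B≡0) ⟨
      (Y i0 + c i0) %B ℓ ≡⟨ cong (_%B ℓ) (m+[n∸m]≡n Yi0≤) ⟩
      X i0 %B ℓ          ∎)
      where open ≡-Reasoning

    -- ... while the other components vanish below ℓ, so c is critical at the lowest nonzero digit of c_{i0}.
    critical-below-ℓ : R ≢ X i0 %B ℓ → Y i0 ≤ X i0 → Critical c
    critical-below-ℓ R≢ Yi0≤ with lowestDigit (c i0) (λ ci0≡0 → c-i0-low≢0 R≢ Yi0≤ (trans (cong (_%B ℓ) ci0≡0) (m<n⇒m%n≡m {{B-nz ℓ}} (B≥1 ℓ))))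
    ... | q , dq≢0 , zq = q , allZero , λ e → dq≢0 (trans (sym (m<n⇒m%n≡m (digit<β (c i0) q))) (trans (cong (_% β q) (sym sumAt-q)) e))
      where
      q<ℓ : q < ℓ
      q<ℓ with q <? ℓ
      ... | yes q<ℓ = q<ℓ
      ... | no q≮ℓ = contradiction (ZeroBelow⇒%B≡0 {ℓ} {c i0} (ZeroBelow-mono (≮⇒≥ q≮ℓ) zq)) (c-i0-low≢0 R≢ Yi0≤)
      others : ∀ i → i ≢ i0 → ZeroBelow q (c i)
      others i i≢i0 = ZeroBelow-mono (<⇒≤ q<ℓ) (c-ZeroBelow i (low-other i i≢i0))
      allZero : ∀ i → ZeroBelow q (c i)
      allZero i with i FP.≟ i0
      ... | yes refl = zq
      ... | no i≢i0 = others i i≢i0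
      sumAt-q : digitSum c q ≡ digit (c i0) q
      sumAt-q = trans (∑-split i0 (λ i → digit (c i) q))
                  (trans (cong (digit (c i0) q +_) (∑-zero othersZero)) (+-identityʳ _))
        where
        othersZero : ∀ i → set i0 0 (λ i → digit (c i) q) i ≡ 0
        othersZero i with i FP.≟ i0
        ... | yes refl = set-self i0 0 _
        ... | no i≢i0 = trans (set-other i0 0 _ i i≢i0) (c-ZeroBelow i (low-other i i≢i0) q q<ℓ)

    critical : (R ≡ X i0 %B ℓ → ∑ (λ i → x i ∸ a i) % β ℓ ≢ 0) → Y i0 ≤ X i0 → Critical c
    critical atℓ Yi0≤ with R ≟ X i0 %B ℓ
    ... | yes R≡ = critical-at-ℓ sameLow (atℓ R≡)
      where
      sameLow : ∀ i → low i ≡ X i %B ℓ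
      sameLow i with i FP.≟ i0
      ... | yes refl = trans (set-self i0 R _) R≡
      ... | no i≢i0 = low-other i i≢i0
    ... | no R≢ = critical-below-ℓ R≢ Yi0≤

    weight≤ : ∀ w (g : Fin k → ℕ) → g i0 ≢ 0 → (∀ i → i ≢ i0 → x i ∸ a i ≢ 0 → g i ≢ 0) → wtv g ≤ w → wtv c ≤ w
    weight≤ w g gi0≢0 supp wg = ≤-trans (wtv-mono c g cSupp) wg
      where
      cSupp : ∀ i → c i ≢ 0 → g i ≢ 0
      cSupp i ci≢0 with i FP.≟ i0
      ... | yes refl = gi0≢0
      ... | no i≢i0 = supp i i≢i0 (λ e → ci≢0 (trans (c≡ i (low-other i i≢i0)) (cong (_* B β ℓ) e)))

    reachable : ∀ w {t} v → IsMord Y t → (∀ p → (digitSum Y p + ones t p) % β p ≡ digit v p) → Y i0 ≤ X i0 →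
                (R ≡ X i0 %B ℓ → ∑ (λ i → x i ∸ a i) % β ℓ ≢ 0) →
                (g : Fin k → ℕ) → g i0 ≢ 0 → (∀ i → i ≢ i0 → x i ∸ a i ≢ 0 → g i ≢ 0) → wtv g ≤ w → Reachable w X v
    reachable w v isMord digits Yi0≤ atℓ g gi0≢0 supp wg =
      Y , IsMord⇒InPmis isMord , Y≤X Yi0≤ , φ≡-byDigits Y v isMord digits , critical atℓ Yi0≤ , weight≤ w g gi0≢0 supp wg

  digit-plain : ∀ s v p → s % β p ≡ v → (s + 0) % β p ≡ v
  digit-plain s v p s≡ = trans (cong (_% β p) (+-identityʳ s)) s≡

  -- Case mord Y = ℓ: take R = 0; below ℓ the other components and v must be "all zero / all maximal",
  -- and the new level-ℓ digit sum must be one more than v_ℓ (it is corrected by β_ℓ − 1 in φ).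
  reach-mordAt-ℓ : ∀ {k} w (X : Vector ℕ k) v ℓ (a : Fin k → ℕ) (i0 : Fin k) → (a≤ : ∀ i → a i ≤ digit (X i) ℓ) →
    (∀ p → p < ℓ → othersSum X i0 p ≡ 0 × digit v p ≡ β p ∸ 1) →
    ∑ a % β ℓ ≡ suc (digit v ℓ) →
    (∀ p → ℓ < p → digitSum X p % β p ≡ digit v p) →
    (0 ≡ X i0 %B ℓ → ∑ (λ i → digit (X i) ℓ ∸ a i) % β ℓ ≢ 0) →
    (g : Fin k → ℕ) → g i0 ≢ 0 → (∀ i → i ≢ i0 → digit (X i) ℓ ∸ a i ≢ 0 → g i ≢ 0) → wtv g ≤ w →
    Reachable w X v
  reach-mordAt-ℓ w X v ℓ a i0 a≤ below atℓ above critℓ =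
    reachable w v isMord digits (Yi0≤Xi0-R0 refl) critℓ
    where
    open Candidate X ℓ a i0 0 (B≥1 ℓ) a≤
    sumBelow : ∀ p → p < ℓ → digitSum Y p ≡ 0
    sumBelow p p< = trans (digitSum-Y-below p p<) (cong₂ _+_ (digit-zero p) (proj₁ (below p p<)))
    isMord : IsMord Y ℓ
    isMord = IsMord-byDigitSums Y ℓ sumBelow (λ sum≡0 → %≡suc⇒≢0 atℓ (trans (sym digitSum-Y-at) sum≡0))
    digits : ∀ p → (digitSum Y p + ones ℓ p) % β p ≡ digit v p
    digits p with <-cmp p ℓ
    ... | tri< p<ℓ _ _ = trans (cong₂ (λ s e → (s + e) % β p) (sumBelow p p<ℓ) (ones-≤ (<⇒≤ p<ℓ)))
                           (trans ([β∸1]%β p) (sym (proj₂ (below p p<ℓ))))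
    ... | tri≈ _ refl _ = trans (cong₂ (λ s e → (s + e) % β p) digitSum-Y-at (ones-≤ ≤-refl))
                            ([s+[n∸1]]%n≡v (∑ a) (digit v p) (β p) (digit<β v p)
                              (trans atℓ (sym (m<n⇒m%n≡m (subst (_< β p) atℓ (m%n<n (∑ a) (β p)))))))
    ... | tri> _ _ ℓ<p = trans (cong₂ (λ s e → (s + e) % β p) (digitSum-Y-above p ℓ<p) (ones-> ℓ<p))
                           (digit-plain (digitSum X p) (digit v p) p (above p ℓ<p))

  -- Case mord Y = t < ℓ: the low part R of the i0-th component is chosen digit by digit so that
  -- the level-p digit sums of Y below ℓ become 0 below t, v_t + 1 at t, and v_p between t and ℓ.
  target : ℕ → ℕ → ℕ → ℕ
  target v t p with <-cmp p t
  ... | tri< _ _ _ = 0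
  ... | tri≈ _ _ _ = suc (digit v t)
  ... | tri> _ _ _ = digit v p

  target-< : ∀ v t p → p < t → target v t p ≡ 0
  target-< v t p p<t with <-cmp p t
  ... | tri< _ _ _ = refl
  ... | tri≈ p≮t _ _ = contradiction p<t p≮t
  ... | tri> p≮t _ _ = contradiction p<t p≮t

  target-≡ : ∀ v t → target v t t ≡ suc (digit v t)
  target-≡ v t with <-cmp t t
  ... | tri< _ t≢t _ = contradiction refl t≢t
  ... | tri≈ _ _ _ = refl
  ... | tri> _ t≢t _ = contradiction refl t≢t

  target-> : ∀ v t p → t < p → target v t p ≡ digit v p
  target-> v t p t<p with <-cmp p t
  ... | tri< _ _ p≯t = contradiction t<p p≯t
  ... | tri≈ _ _ p≯t = contradiction t<p p≯t
  ... | tri> _ _ _ = refl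

  lowDigit : ∀ {k} → Vector ℕ k → Fin k → ℕ → ℕ → ℕ → ℕ
  lowDigit X i0 v t p = (target v t p + (β p ∸ othersSum X i0 p % β p)) % β p

  lowPart : ∀ {k} → Vector ℕ k → Fin k → ℕ → ℕ → ℕ → ℕ
  lowPart X i0 v t ℓ = fromDigits ℓ (lowDigit X i0 v t)

  lowPart<B : ∀ {k} (X : Vector ℕ k) i0 v t ℓ → lowPart X i0 v t ℓ < B β ℓ
  lowPart<B X i0 v t ℓ = fromDigits<B ℓ (lowDigit X i0 v t) (λ p _ → m%n<n _ (β p))

  digit-lowPart : ∀ {k} (X : Vector ℕ k) i0 v t ℓ p → p < ℓ → digit (lowPart X i0 v t ℓ) p ≡ lowDigit X i0 v t p
  digit-lowPart X i0 v t ℓ p p< = digit-fromDigits ℓ (lowDigit X i0 v t) (λ p _ → m%n<n _ (β p)) p p<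

  lowPart-hitsTarget : ∀ {k} (X : Vector ℕ k) i0 v t ℓ p → p < ℓ →
                       (digit (lowPart X i0 v t ℓ) p + othersSum X i0 p) % β p ≡ target v t p % β p
  lowPart-hitsTarget X i0 v t ℓ p p< = begin
    (digit (lowPart X i0 v t ℓ) p + o) % β p        ≡⟨ cong (λ z → (z + o) % β p) (digit-lowPart X i0 v t ℓ p p<) ⟩
    (lowDigit X i0 v t p + o) % β p                 ≡⟨ %-absorbˡ (τ + (β p ∸ o % β p)) o (β p) ⟩
    (τ + (β p ∸ o % β p) + o) % β p                 ≡⟨ %-absorbʳ (τ + (β p ∸ o % β p)) o (β p) ⟨
    (τ + (β p ∸ o % β p) + o % β p) % β p           ≡⟨ cong (_% β p) (trans (+-assoc τ _ _) (cong (τ +_) (m∸n+n≡m (<⇒≤ (m%n<n o (β p)))))) ⟩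
    (τ + β p) % β p                                 ≡⟨ [m+n]%n≡m%n τ (β p) ⟩
    τ % β p                                         ∎
    where
    open ≡-Reasoning
    o = othersSum X i0 p
    τ = target v t p

  lowPart-zero : ∀ {k} (X : Vector ℕ k) i0 v t ℓ p → p < ℓ → p < t → othersSum X i0 p ≡ 0 → digit (lowPart X i0 v t ℓ) p ≡ 0
  lowPart-zero X i0 v t ℓ p p<ℓ p<t others≡0 = trans (digit-lowPart X i0 v t ℓ p p<ℓ)
    (trans (cong₂ (λ x y → (x + (β p ∸ y % β p)) % β p) (target-< v t p p<t) others≡0)
      (trans (cong (λ y → (β p ∸ y) % β p) (0%β p)) (n%n≡0 (β p))))

  reach-mordBelow-ℓ : ∀ {k} w (X : Vector ℕ k) v ℓ (a : Fin k → ℕ) (i0 : Fin k) → (a≤ : ∀ i → a i ≤ digit (X i) ℓ) →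
    ∀ t → t < ℓ →
    (othersSum X i0 t ≢ 0 ⊎ digit v t ≢ β t ∸ 1) →
    (∀ p → p < t → othersSum X i0 p ≡ 0 × digit v p ≡ β p ∸ 1) →
    ∑ a % β ℓ ≡ digit v ℓ →
    (∀ p → ℓ < p → digitSum X p % β p ≡ digit v p) →
    a i0 < digit (X i0) ℓ →
    (lowPart X i0 v t ℓ ≡ X i0 %B ℓ → ∑ (λ i → digit (X i) ℓ ∸ a i) % β ℓ ≢ 0) →
    (g : Fin k → ℕ) → g i0 ≢ 0 → (∀ i → i ≢ i0 → digit (X i) ℓ ∸ a i ≢ 0 → g i ≢ 0) → wtv g ≤ w →
    Reachable w X v
  reach-mordBelow-ℓ {k} w X v ℓ a i0 a≤ t t<ℓ nonMaximal-t below atℓ above ai0<xi0 critℓ =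
    reachable w v isMord digits (Yi0≤Xi0-lower ai0<xi0) critℓ
    where
    R = lowPart X i0 v t ℓ
    open Candidate X ℓ a i0 R (lowPart<B X i0 v t ℓ) a≤
    sumBelow : ∀ p → p < t → digitSum Y p ≡ 0
    sumBelow p p<t = trans (digitSum-Y-below p (<-trans p<t t<ℓ))
      (cong₂ _+_ (lowPart-zero X i0 v t ℓ p (<-trans p<t t<ℓ) p<t (proj₁ (below p p<t))) (proj₁ (below p p<t)))
    sumMod : ∀ p → p < ℓ → digitSum Y p % β p ≡ target v t p % β p
    sumMod p p<ℓ = trans (cong (_% β p) (digitSum-Y-below p p<ℓ)) (lowPart-hitsTarget X i0 v t ℓ p p<ℓ)
    sumAt-t : digitSum Y t ≢ 0
    sumAt-t = [ others≢0 , v≢max ]′ nonMaximal-t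
      where
      others≢0 : othersSum X i0 t ≢ 0 → digitSum Y t ≢ 0
      others≢0 o≢0 sum≡0 = o≢0 (n≤0⇒n≡0 (≤-trans (m≤n+m _ (digit R t)) (≤-reflexive (trans (sym (digitSum-Y-below t t<ℓ)) sum≡0))))
      v≢max : digit v t ≢ β t ∸ 1 → digitSum Y t ≢ 0
      v≢max vt≢ = %≡suc⇒≢0 (trans (sumMod t t<ℓ) (trans (cong (_% β t) (target-≡ v t)) (m<n⇒m%n≡m (<∧≢∸1⇒1+< (digit<β v t) vt≢))))
    isMord : IsMord Y t
    isMord = IsMord-byDigitSums Y t sumBelow sumAt-t
    digits : ∀ p → (digitSum Y p + ones t p) % β p ≡ digit v p
    digits p with <-cmp p t
    ... | tri< p<t _ _ = trans (cong₂ (λ s e → (s + e) % β p) (sumBelow p p<t) (ones-≤ (<⇒≤ p<t)))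
                           (trans ([β∸1]%β p) (sym (proj₂ (below p p<t))))
    ... | tri≈ _ refl _ = trans (cong (λ e → (digitSum Y p + e) % β p) (ones-≤ ≤-refl))
                            ([s+[n∸1]]%n≡v (digitSum Y p) (digit v p) (β p) (digit<β v p)
                              (trans (sumMod p t<ℓ) (cong (_% β p) (target-≡ v p))))
    ... | tri> _ _ t<p with <-cmp p ℓ
    ...   | tri< p<ℓ _ _ = trans (cong (λ e → (digitSum Y p + e) % β p) (ones-> t<p))
                             (digit-plain (digitSum Y p) (digit v p) p
                               (trans (sumMod p p<ℓ) (trans (cong (_% β p) (target-> v t p t<p)) (m<n⇒m%n≡m (digit<β v p)))))
    ...   | tri≈ _ refl _ = trans (cong₂ (λ s e → (s + e) % β p) digitSum-Y-at (ones-> t<p)) (digit-plain (∑ a) (digit v p) p atℓ)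
    ...   | tri> _ _ ℓ<p = trans (cong₂ (λ s e → (s + e) % β p) (digitSum-Y-above p ℓ<p) (ones-> t<p))
                             (digit-plain (digitSum X p) (digit v p) p (above p ℓ<p))

  topDifference : ∀ v u → v < u → ∃ λ L → digit v L < digit u L × (∀ p → L < p → digit v p ≡ digit u p)
  topDifference v u v<u with below u (subst₂ _<_ (sym (m<n⇒m%n≡m {{B-nz u}} v<B)) (sym (m<n⇒m%n≡m {{B-nz u}} (n<B[n] u))) v<u)
    where
    v<B : v < B β u
    v<B = <-trans v<u (n<B[n] u)
    below : ∀ N → v %B N < u %B N →
            ∃ λ L → L < N × digit v L < digit u L × (∀ p → L < p → p < N → digit v p ≡ digit u p)
    below zero lt = contradiction (trans (n%1≡0 v) (sym (n%1≡0 u))) (<⇒≢ lt)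
    below (suc N) lt with <-cmp (digit v N) (digit u N)
    ... | tri< vN<uN _ _ = N , ≤-refl , vN<uN , λ p N<p p<1+N → contradiction (≤-trans p<1+N N<p) (<-irrefl refl)
    ... | tri≈ _ vN≡uN _ with below N lowerParts<
      where
      lowerParts< : v %B N < u %B N
      lowerParts< = +-cancelʳ-< (digit u N * B β N) (v %B N) (u %B N)
                      (subst (_< u %B N + digit u N * B β N) (cong (λ d → v %B N + d * B β N) vN≡uN)
                        (subst₂ _<_ (%B-suc v N) (%B-suc u N) lt))
    ...   | L , L<N , vL<uL , same = L , ≤-trans L<N (n≤1+n N) , vL<uL ,
                                     λ p L<p p<1+N → [ same p L<p , (λ { refl → vN≡uN }) ]′ (m≤n⇒m<n∨m≡n (≤-pred p<1+N))
    below (suc N) lt | tri> _ _ uN<vN = contradiction (subst₂ _≤_ (sym (%B-suc u N)) (sym (%B-suc v N)) u≤v) (<⇒≱ lt)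
      where
      u≤v : u %B N + digit u N * B β N ≤ v %B N + digit v N * B β N
      u≤v = ≤-trans (<⇒≤ (+-monoˡ-< (digit u N * B β N) (m%n<n u (B β N) {{B-nz N}})))
              (≤-trans (*-monoˡ-≤ (B β N) uN<vN) (m≤n+m _ _))
  ... | L , _ , vL<uL , same = L , vL<uL , sameAbove
    where
    sameAbove : ∀ p → L < p → digit v p ≡ digit u p
    sameAbove p L<p with p <? u
    ... | yes p<u = same p L<p p<u
    ... | no p≮u = trans (digit-above (<-trans v<u (n<B[n] u)) (≮⇒≥ p≮u)) (sym (digit-above (n<B[n] u) (≮⇒≥ p≮u)))

  NonMaximal : ∀ {k} → Vector ℕ k → Fin k → ℕ → ℕ → Set
  NonMaximal X i0 v p = othersSum X i0 p ≢ 0 ⊎ digit v p ≢ β p ∸ 1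

  NonMaximal? : ∀ {k} (X : Vector ℕ k) i0 v p → Dec (NonMaximal X i0 v p)
  NonMaximal? X i0 v p = ¬? (_ ≟ 0) ⊎-dec ¬? (_ ≟ _)

  ¬NonMaximal⇒ : ∀ {k} (X : Vector ℕ k) i0 v p → ¬ NonMaximal X i0 v p → othersSum X i0 p ≡ 0 × digit v p ≡ β p ∸ 1
  ¬NonMaximal⇒ X i0 v p ¬nm = decidable-stable (_ ≟ _) (¬nm ∘ inj₁) , decidable-stable (_ ≟ _) (¬nm ∘ inj₂)

  othersSum-belowMord : ∀ {k} (X : Vector ℕ k) i0 {m p} → (∀ i → ZeroBelow m (X i)) → p < m → othersSum X i0 p ≡ 0
  othersSum-belowMord X i0 {m} {p} z p<m = ∑-zero others
    where
    others : ∀ i → set i0 0 (λ i → digit (X i) p) i ≡ 0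
    others i with i FP.≟ i0
    ... | yes refl = set-self i0 0 _
    ... | no i≢i0 = trans (set-other i0 0 _ i i≢i0) (z i p p<m)

  module Removal {k} (x g : Fin k → ℕ) (g≤x : ∀ i → g i ≤ x i) (i0 : Fin k) (gi0≢0 : g i0 ≢ 0) where
    a : Fin k → ℕ
    a i = x i ∸ g i

    a≤x : ∀ i → a i ≤ x i
    a≤x i = m∸n≤m (x i) (g i)

    x∸a≡g : ∀ i → x i ∸ a i ≡ g i
    x∸a≡g i = m∸[m∸n]≡n (g≤x i)

    ai0<xi0 : a i0 < x i0
    ai0<xi0 = ∸-monoʳ-< {x i0} {g i0} {0} (n≢0⇒n>0 gi0≢0) (g≤x i0)

    ∑a≡ : ∑ a ≡ ∑ x ∸ ∑ g
    ∑a≡ = ∑-∸ x g g≤x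

    support : ∀ i → i ≢ i0 → x i ∸ a i ≢ 0 → g i ≢ 0
    support i _ ne gi≡0 = ne (trans (x∸a≡g i) gi≡0)

    removed-critical : ∀ ℓ → 0 < ∑ g → ∑ g < β ℓ → ∑ (λ i → x i ∸ a i) % β ℓ ≢ 0
    removed-critical ℓ 0<∑g ∑g<β e =
      <⇒≢ 0<∑g (sym (trans (sym (m<n⇒m%n≡m ∑g<β)) (trans (cong (_% β ℓ) (sym (∑-cong x∸a≡g))) e)))

  weight-above0 : ∀ {k} w → (∀ L → fβk β k L ≤ w) → ∀ L (g : Fin k → ℕ) d → wtv g ≤ d → d ≤ β (suc L) → wtv g ≤ w
  weight-above0 {k} w budget L g d wg≤d d≤β = ≤-trans (⊓-glb wg≤d (wtv≤k g)) (≤-trans (⊓-monoˡ-≤ k d≤β) (budget (suc L)))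

  -- Case 1: the top differing level L of v < φ X lies above m = mord X. There φ shows the digit
  -- sum of X, so we lower that sum by d = u_L − v_L, using at most d < β_L components.
  module AboveMord {k} w (budget : ∀ L → fβk β k L ≤ w) (X : Vector ℕ k) v m L'
                   (mordX : mord X ≡ just m) (m<L : m < suc L') (vL<uL : digit v (suc L') < digit (φ k X) (suc L'))
                   (above : ∀ p → suc L' < p → digitSum X p % β p ≡ digit v p)
                   (g : Fin k → ℕ) (g≤x : ∀ i → g i ≤ digit (X i) (suc L'))
                   (∑g≡d : ∑ g ≡ digit (φ k X) (suc L') ∸ digit v (suc L'))
                   (wg≤d : wtv g ≤ digit (φ k X) (suc L') ∸ digit v (suc L'))
                   (i0 : Fin k) (gi0≢0 : g i0 ≢ 0) where
    L = suc L'
    x : Fin k → ℕ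
    x i = digit (X i) L
    uL = digit (φ k X) L
    vL = digit v L
    d = uL ∸ vL

    uL≡ : uL ≡ digitSum X L % β L
    uL≡ = digit-φ-above X mordX L m<L

    d≤%β : d ≤ digitSum X L % β L
    d≤%β = ≤-trans (m∸n≤m uL vL) (≤-reflexive uL≡)

    d<β : d < β L
    d<β = ≤-<-trans (m∸n≤m uL vL) (digit<β (φ k X) L)

    0<d : 0 < d
    0<d = m<n⇒0<n∸m vL<uL

    open Removal x g g≤x i0 gi0≢0

    sumAt-L : ∑ a % β L ≡ vL
    sumAt-L = begin
      ∑ a % β L                     ≡⟨ cong (_% β L) (trans ∑a≡ (cong (digitSum X L ∸_) ∑g≡d)) ⟩
      (digitSum X L ∸ d) % β L      ≡⟨ [m∸d]%n≡m%n∸d (digitSum X L) d (β L) d≤%β ⟩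
      digitSum X L % β L ∸ d        ≡⟨ cong (_∸ d) uL≡ ⟨
      uL ∸ (uL ∸ vL)                ≡⟨ m∸[m∸n]≡n (<⇒≤ vL<uL) ⟩
      vL                            ∎
      where open ≡-Reasoning

    critical-L : ∑ (λ i → x i ∸ a i) % β L ≢ 0
    critical-L = removed-critical L (subst (0 <_) (sym ∑g≡d) 0<d) (subst (_< β L) (sym ∑g≡d) d<β)

    weight : wtv g ≤ w
    weight = weight-above0 w budget L' g d wg≤d (<⇒≤ d<β)

    -- If v is non-maximal somewhere below L, the least such level t becomes the new minimal order.
    reachBelow : ∀ t → t < L → NonMaximal X i0 v t → (∀ p → p < t → ¬ NonMaximal X i0 v p) → Reachable w X v
    reachBelow t t<L nonMax maxBelow = reach-mordBelow-ℓ w X v L a i0 a≤x t t<L nonMax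
      (λ p p< → ¬NonMaximal⇒ X i0 v p (maxBelow p p<)) sumAt-L above ai0<xi0 (λ _ → critical-L)
      g gi0≢0 support weight

    -- Otherwise the new minimal order is L: keep one more unit at i0 to absorb the shift β_L − 1.
    reachAt : (∀ p → p < L → ¬ NonMaximal X i0 v p) → Reachable w X v
    reachAt maxBelow = reach-mordAt-ℓ w X v L a' i0 a'≤x
      (λ p p< → ¬NonMaximal⇒ X i0 v p (maxBelow p p<)) sumAt-L' above critical-L' g gi0≢0 support' weight
      where
      a' : Fin k → ℕ
      a' = set i0 (suc (a i0)) a
      a'≤x : ∀ i → a' i ≤ x i
      a'≤x i with i FP.≟ i0
      ... | yes refl = subst (_≤ x i) (sym (set-self i0 (suc (a i0)) a)) ai0<xi0
      ... | no i≢i0 = subst (_≤ x i) (sym (set-other i0 (suc (a i0)) a i i≢i0)) (a≤x i)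
      sumAt-L' : ∑ a' % β L ≡ suc vL
      sumAt-L' = begin
        ∑ a' % β L                ≡⟨ cong (_% β L) (trans (∑-set i0 (suc (a i0)) a) (cong suc (sym (∑-split i0 a)))) ⟩
        (1 + ∑ a) % β L           ≡⟨ %-absorbʳ 1 (∑ a) (β L) ⟨
        (1 + ∑ a % β L) % β L     ≡⟨ cong (λ z → (1 + z) % β L) sumAt-L ⟩
        suc vL % β L              ≡⟨ m<n⇒m%n≡m (≤-<-trans vL<uL (digit<β (φ k X) L)) ⟩
        suc vL                    ∎
        where open ≡-Reasoning
      -- R = 0 is not the old low part of X_{i0}, since X has a nonzero digit at level m < L
      critical-L' : 0 ≡ X i0 %B L → ∑ (λ i → x i ∸ a' i) % β L ≢ 0
      critical-L' low≡0 _ with mord≡just⇒ X mordX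
      ... | _ , j , dj≢0 with j FP.≟ i0
      ...   | yes refl = dj≢0 (%B≡0⇒ZeroBelow {L} {X j} (sym low≡0) m m<L)
      ...   | no j≢i0 = dj≢0 (∑-others≡0 i0 (λ i → digit (X i) m) (proj₁ (¬NonMaximal⇒ X i0 v m (maxBelow m m<L))) j j≢i0)
      support' : ∀ i → i ≢ i0 → x i ∸ a' i ≢ 0 → g i ≢ 0
      support' i i≢i0 = support i i≢i0 ∘ subst (λ z → x i ∸ z ≢ 0) (set-other i0 (suc (a i0)) a i i≢i0)

    reach : Reachable w X v
    reach with least (NonMaximal X i0 v) (NonMaximal? X i0 v) L
    ... | inj₁ (t , t<L , nonMax , maxBelow) = reachBelow t t<L nonMax maxBelow
    ... | inj₂ maxBelow = reachAt maxBelow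

  -- At level 0 with β_0 < 2k the budget is only k − 1, so a component with least digit is left alone.
  takeDecrement : ∀ {k} w → (∀ L → fβk β k L ≤ w) → (X : Vector ℕ k) → ∀ m τ → (dec : Decrement (digitSum X m) (β m) τ) →
                  (m ≡ 0 → 1 ≤ τ) → ∃ λ g → (∀ i → g i ≤ digit (X i) m) × ∑ g ≡ Decrement.e dec × wtv g ≤ w
  takeDecrement {k} w budget X (suc m) τ dec _ with takeAmount (λ i → digit (X i) (suc m)) (Decrement.e dec) (Decrement.e≤S dec)
  ... | g , g≤x , ∑g , wg = g , g≤x , ∑g , weight-above0 w budget m g _ wg (Decrement.e≤n dec)
  takeDecrement {k} w budget X zero τ dec pos with β 0 <ᵇ 2 * k in β0<2k
  ... | false with takeAmount (λ i → digit (X i) 0) (Decrement.e dec) (Decrement.e≤S dec)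
  ...   | g , g≤x , ∑g , wg = g , g≤x , ∑g ,
          ≤-trans (⊓-glb wg (wtv≤k g)) (≤-trans (⊓-monoˡ-≤ k (Decrement.e≤n∸1 dec (pos refl))) (budget 0))
  takeDecrement {suc k} w budget X zero τ dec pos | true with argmin (λ i → digit (X i) 0)
  ...   | j , xj≤ with takeAmountAvoiding (λ i → digit (X i) 0) j (Decrement.e dec) e≤S∸xj
    where
    S = digitSum X 0
    xj = digit (X j) 0
    e≤S∸xj : Decrement.e dec ≤ S ∸ xj
    e≤S∸xj with xj ≤? 1
    ... | yes xj≤1 = ≤-trans (m+n≤o⇒m≤o∸n _ (Decrement.e<S dec (pos refl))) (∸-monoʳ-≤ S xj≤1)
    ... | no xj≰1 = ≤-trans (m+n≤o⇒m≤o∸n _ (Decrement.e+n≤S dec (pos refl) β<S)) (∸-monoʳ-≤ S (<⇒≤ (digit<β (X j) 0)))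
      where
      -- every digit is ≥ 2, so S ≥ 2k > β_0
      β<S : β 0 < S
      β<S = <-≤-trans (<ᵇ⇒< (β 0) (2 * suc k) (subst T (sym β0<2k) tt))
              (≤-trans (≤-reflexive (*-comm 2 (suc k))) (≤-trans (*-monoʳ-≤ (suc k) (≰⇒> xj≰1)) (∑-lowerBound _ xj xj≤)))
  ...     | g , g≤x , ∑g , wg , gj≡0 = g , g≤x , ∑g ,
            ≤-trans (⊓-glb wg (wtv≤k∸1 g j gj≡0)) (≤-trans (⊓-monoˡ-≤ k (Decrement.e≤n∸1 dec (pos refl))) (budget 0))

  data BelowMord (v m τ : ℕ) : Set where
    newMord : ∀ t → t < m → digit v t ≢ β t ∸ 1 → (∀ p → p < t → digit v p ≡ β p ∸ 1) → τ ≡ digit v m → BelowMord v m τ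
    sameMord : (∀ p → p < m → digit v p ≡ β p ∸ 1) → τ ≡ suc (digit v m) → BelowMord v m τ

  -- Case 2: the top differing level is at most m = mord X. Then the level-m digit sum S of X is
  -- lowered so that its new residue is τ (τ = v_m if the new minimal order will be below m,
  -- τ = v_m + 1 if it stays m).
  module AtOrBelowMord {k} w (budget : ∀ L → fβk β k L ≤ w) (X : Vector ℕ k) v m (mordX : mord X ≡ just m)
                       (above : ∀ p → m < p → digitSum X p % β p ≡ digit v p) τ
                       (dec : Decrement (digitSum X m) (β m) τ)
                       (g : Fin k → ℕ) (g≤x : ∀ i → g i ≤ digit (X i) m) (∑g≡e : ∑ g ≡ Decrement.e dec) (weight : wtv g ≤ w)
                       (i0 : Fin k) (gi0≢0 : g i0 ≢ 0) where
    x : Fin k → ℕ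
    x i = digit (X i) m

    zeroBelow : ∀ i → ZeroBelow m (X i)
    zeroBelow = proj₁ (mord≡just⇒ X mordX)

    open Removal x g g≤x i0 gi0≢0

    sumAt-m : ∑ a % β m ≡ τ
    sumAt-m = trans (cong (_% β m) (trans ∑a≡ (cong (digitSum X m ∸_) ∑g≡e))) (Decrement.residue dec)

    others-below : ∀ p → p < m → othersSum X i0 p ≡ 0
    others-below p p<m = othersSum-belowMord X i0 zeroBelow p<m

    -- The new minimal order is the least level t < m where v is not maximal.
    reachBelow : ∀ t → t < m → digit v t ≢ β t ∸ 1 → (∀ p → p < t → digit v p ≡ β p ∸ 1) → τ ≡ digit v m → Reachable w X v
    reachBelow t t<m vt≢max maxBelow τ≡ = reach-mordBelow-ℓ w X v m a i0 a≤x t t<m (inj₂ vt≢max)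
      (λ p p<t → others-below p (<-trans p<t t<m) , maxBelow p p<t) (trans sumAt-m τ≡) above ai0<xi0 lowPart≢
      g gi0≢0 support weight
      where
      -- X_{i0} vanishes below m, while the new low part has the nonzero digit v_t + 1 at t
      lowPart≢ : lowPart X i0 v t m ≡ X i0 %B m → ∑ (λ i → x i ∸ a i) % β m ≢ 0
      lowPart≢ R≡ _ = 1+n≢0 (begin
        suc (digit v t)                                                  ≡⟨ m<n⇒m%n≡m (<∧≢∸1⇒1+< (digit<β v t) vt≢max) ⟨
        suc (digit v t) % β t                                            ≡⟨ [m+n]%n≡m%n (suc (digit v t)) (β t) ⟨
        (suc (digit v t) + β t) % β t                                    ≡⟨ cong₂ (λ s o → (s + (β t ∸ o)) % β t) (target-≡ v t)
                                                                              (trans (cong (_% β t) (others-below t t<m)) (0%β t)) ⟨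
        (target v t t + (β t ∸ othersSum X i0 t % β t)) % β t            ≡⟨ digit-lowPart X i0 v t m t t<m ⟨
        digit (lowPart X i0 v t m) t                                     ≡⟨ cong (λ n → digit n t) (trans R≡ (ZeroBelow⇒%B≡0 (zeroBelow i0))) ⟩
        digit 0 t                                                        ≡⟨ digit-zero t ⟩
        0                                                                ∎)
        where open ≡-Reasoning

    -- If v is maximal below m, the minimal order stays m.
    reachAt : (∀ p → p < m → digit v p ≡ β p ∸ 1) → τ ≡ suc (digit v m) → Reachable w X v
    reachAt maxBelow τ≡ = reach-mordAt-ℓ w X v m a i0 a≤x (λ p p< → others-below p p< , maxBelow p p<)
      (trans sumAt-m τ≡) above (λ _ → removed-critical m (subst (0 <_) (sym ∑g≡e) (Decrement.1≤e dec)) e<β)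
      g gi0≢0 support weight
      where
      e<β : ∑ g < β m
      e<β = subst (_< β m) (sym ∑g≡e) (≤-<-trans (Decrement.e≤n∸1 dec (subst (1 ≤_) (sym τ≡) (s≤s z≤n))) (n∸1<n (β m)))

    reach : BelowMord v m τ → Reachable w X v
    reach (newMord t t<m vt≢max maxBelow τ≡) = reachBelow t t<m vt≢max maxBelow τ≡
    reach (sameMord maxBelow τ≡) = reachAt maxBelow τ≡

  digitSum-atMord≢0 : ∀ {k} (X : Vector ℕ k) {m} → mord X ≡ just m → digitSum X m ≢ 0
  digitSum-atMord≢0 X {m} mordX S≡0 with mord≡just⇒ X mordX
  ... | _ , i , dmi≢0 = dmi≢0 (n≤0⇒n≡0 (≤-trans (≤∑ (λ i → digit (X i) m) i) (≤-reflexive S≡0)))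

  reach-atMord : ∀ {k} w → (∀ L → fβk β k L ≤ w) → (X : Vector ℕ k) → ∀ v m → mord X ≡ just m →
                 (∀ p → m < p → digitSum X p % β p ≡ digit v p) →
                 ∀ τ → τ ≤ digit (φ k X) m → (m ≡ 0 → 1 ≤ τ) → BelowMord v m τ → Reachable w X v
  reach-atMord {k} w budget X v m mordX above τ τ≤um pos shape
    with decrement (digitSum X m) (β m) τ (digitSum-atMord≢0 X mordX) (≤-trans τ≤um (≤-reflexive (digit-φ-below X mordX m ≤-refl)))
  ... | dec with takeDecrement w budget X m τ dec pos
  ...   | g , g≤x , ∑g≡e , wg with ∑≢0⇒∃≢0 g (λ ∑g≡0 → <⇒≢ (Decrement.1≤e dec) (sym (trans (sym ∑g≡e) ∑g≡0)))
  ...     | i0 , gi0≢0 = AtOrBelowMord.reach w budget X v m mordX above τ dec g g≤x ∑g≡e wg i0 gi0≢0 shape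

  reach-atOrBelowMord : ∀ {k} w → (∀ L → fβk β k L ≤ w) → (X : Vector ℕ k) → ∀ v m L → mord X ≡ just m → L ≤ m →
                        digit v L < digit (φ k X) L → (∀ p → L < p → digit v p ≡ digit (φ k X) p) →
                        (∀ p → m < p → digitSum X p % β p ≡ digit v p) → Reachable w X v
  reach-atOrBelowMord {k} w budget X v m L mordX L≤m vL<uL same above
    with least (λ p → digit v p ≢ β p ∸ 1) (λ p → ¬? (_ ≟ _)) m
  ... | inj₁ (t , t<m , vt≢max , maxBelow) =
        reach-atMord w budget X v m mordX above (digit v m) vm≤um (λ { refl → contradiction t<m n≮0 })
          (newMord t t<m vt≢max (λ p p< → decidable-stable (_ ≟ _) (maxBelow p p<)) refl)
    where
    vm≤um : digit v m ≤ digit (φ k X) m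
    vm≤um with m≤n⇒m<n∨m≡n L≤m
    ... | inj₁ L<m = ≤-reflexive (same m L<m)
    ... | inj₂ refl = <⇒≤ vL<uL
  ... | inj₂ maxBelow =
        reach-atMord w budget X v m mordX above (suc (digit v m)) vm<um (λ _ → s≤s z≤n)
          (sameMord (λ p p< → decidable-stable (_ ≟ _) (maxBelow p p<)) refl)
    where
    -- below m φ X shows maximal digits, so the top difference must be at m itself
    vm<um : suc (digit v m) ≤ digit (φ k X) m
    vm<um with m≤n⇒m<n∨m≡n L≤m
    ... | inj₂ refl = vL<uL
    ... | inj₁ L<m = contradiction (<⇒≢ (≤-trans vL<uL (≤-reflexive uL≡max))) (maxBelow L L<m)
      where
      uL≡max : digit (φ k X) L ≡ β L ∸ 1
      uL≡max = trans (digit-φ-below X mordX L (<⇒≤ L<m))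
                 (trans (cong (λ s → (s + (β L ∸ 1)) % β L) (∑-zero (λ i → proj₁ (mord≡just⇒ X mordX) i L L<m)))
                   ([β∸1]%β L))

  reach-aboveMord : ∀ {k} w → (∀ L → fβk β k L ≤ w) → (X : Vector ℕ k) → ∀ v m L' → mord X ≡ just m → m < suc L' →
                    digit v (suc L') < digit (φ k X) (suc L') → (∀ p → suc L' < p → digitSum X p % β p ≡ digit v p) →
                    Reachable w X v
  reach-aboveMord {k} w budget X v m L' mordX m<L vL<uL above
    with takeAmount (λ i → digit (X i) (suc L')) (digit (φ k X) (suc L') ∸ digit v (suc L'))
           (≤-trans (m∸n≤m _ (digit v (suc L')))
             (≤-trans (≤-reflexive (digit-φ-above X mordX (suc L') m<L)) (m%n≤m (digitSum X (suc L')) (β (suc L')))))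
  ... | g , g≤x , ∑g≡d , wg with ∑≢0⇒∃≢0 g (λ ∑g≡0 → <⇒≢ (m<n⇒0<n∸m vL<uL) (sym (trans (sym ∑g≡d) ∑g≡0)))
  ...   | i0 , gi0≢0 = AboveMord.reach w budget X v m L' mordX m<L vL<uL above g g≤x ∑g≡d wg i0 gi0≢0

  -- Above both the top difference and mord X, v agrees with φ X, which shows digit sums there.
  above-agree : ∀ {k} (X : Vector ℕ k) v m L → mord X ≡ just m → (∀ p → L < p → digit v p ≡ digit (φ k X) p) →
                ∀ ℓ → L ≤ ℓ → m ≤ ℓ → ∀ p → ℓ < p → digitSum X p % β p ≡ digit v p
  above-agree X v m L mordX same ℓ L≤ℓ m≤ℓ p ℓ<p =
    sym (trans (same p (≤-<-trans L≤ℓ ℓ<p)) (digit-φ-above X mordX p (≤-<-trans m≤ℓ ℓ<p)))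

  smaller-values-reachable : ∀ {k} w → (∀ L → fβk β k L ≤ w) → (X : Vector ℕ k) → InPmis X → ∀ v → v < φ k X → Reachable w X v
  smaller-values-reachable {k} w budget X X∈P v v<u with mord-finite X X∈P | topDifference v (φ k X) v<u
  ... | m , mordX | L , vL<uL , same with m <? L
  ...   | no m≮L = reach-atOrBelowMord w budget X v m L mordX (≮⇒≥ m≮L) vL<uL same
                     (above-agree X v m L mordX same m (≮⇒≥ m≮L) ≤-refl)
  smaller-values-reachable {k} w budget X X∈P v v<u | m , mordX | suc L' , vL<uL , same | yes m<L =
    reach-aboveMord w budget X v m L' mordX m<L vL<uL (above-agree X v m (suc L') mordX same (suc L') ≤-refl (<⇒≤ m<L))

  WeightWitness : ℕ → ℕ → Set
  WeightWitness k j = ∃ λ (X : Vector ℕ k) → InPmis X × φ k X ≢ 0 ×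
                        (∀ (Y c : Vector ℕ k) → InPmis Y → (∀ i → X i ≡ Y i + c i) → φ k Y ≡ 0 → j ≤ wtv c)

  -- As 0 < φ X = mex of the option values, X has an option of value 0; so every C ∈ Δ(φ)
  -- contains a move of weight at least j.
  witness⇒weight≥ : ∀ {k j} → WeightWitness k j → ∀ C → InΔ (φ k) C → ∀ w → WtSetLE C w → j ≤ w
  witness⇒weight≥ (X , X∈P , φX≢0 , heavy) C (_ , isSG) w wtC≤w with proj₂ (isSG X X∈P) 0 (n≢0⇒n>0 φX≢0)
  ... | Y , (_ , Y∈P , c , c∈C , X≡Y+c) , φY≡0 = ≤-trans (heavy Y c Y∈P X≡Y+c φY≡0) (wtC≤w c c∈C)

  φ≢0-byDigit : ∀ {k} (X : Vector ℕ k) p → digit (φ k X) p ≢ 0 → φ k X ≢ 0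
  φ≢0-byDigit X p dp≢0 φX≡0 = dp≢0 (trans (cong (λ n → digit n p) φX≡0) (digit-zero p))

  -- At level 0 φ always adds β_0 − 1, so a position of value 0 has level-0 digit sum ≡ 1 and
  -- minimal order 0, and then its digit sums at all levels L ≥ 1 are ≡ 0.
  φ≡0⇒sum₀≡1 : ∀ {k} (Y : Vector ℕ k) → InPmis Y → φ k Y ≡ 0 → digitSum Y 0 % β 0 ≡ 1
  φ≡0⇒sum₀≡1 {k} Y Y∈P φY≡0 with mord-finite Y Y∈P
  ... | m , mordY = [s+[n∸1]]%n≡0⇒s≡1 (hβ 0) (m%n<n (digitSum Y 0) (β 0)) (begin
    (digitSum Y 0 % β 0 + (β 0 ∸ 1)) % β 0    ≡⟨ %-absorbˡ (digitSum Y 0) (β 0 ∸ 1) (β 0) ⟩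
    (digitSum Y 0 + (β 0 ∸ 1)) % β 0          ≡⟨ digit-φ-below Y mordY 0 z≤n ⟨
    digit (φ k Y) 0                          ≡⟨ cong (λ n → digit n 0) φY≡0 ⟩
    digit 0 0                                ≡⟨ digit-zero 0 ⟩
    0                                        ∎)
    where open ≡-Reasoning

  sum₀≡1⇒mord≡0 : ∀ {k} (Y : Vector ℕ k) → digitSum Y 0 % β 0 ≡ 1 → mord Y ≡ just 0
  sum₀≡1⇒mord≡0 Y sum₀≡1 = IsMord⇒mord≡ Y (IsMord-byDigitSums Y 0 (λ p ()) sum≢0)
    where
    sum≢0 : digitSum Y 0 ≢ 0
    sum≢0 sum≡0 = 0≢1+n (trans (sym (0%β 0)) (trans (cong (_% β 0) (sym sum≡0)) sum₀≡1))

  φ≡0⇒sum≡0 : ∀ {k} (Y : Vector ℕ k) → InPmis Y → φ k Y ≡ 0 → ∀ L → 1 ≤ L → digitSum Y L % β L ≡ 0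
  φ≡0⇒sum≡0 {k} Y Y∈P φY≡0 L 1≤L = begin
    digitSum Y L % β L      ≡⟨ digit-φ-above Y (sum₀≡1⇒mord≡0 Y (φ≡0⇒sum₀≡1 Y Y∈P φY≡0)) L 1≤L ⟨
    digit (φ k Y) L         ≡⟨ cong (λ n → digit n L) φY≡0 ⟩
    digit 0 L               ≡⟨ digit-zero L ⟩
    0                       ∎
    where open ≡-Reasoning

  digit₀-small : ∀ n → n < β 0 → digit n 0 ≡ n
  digit₀-small n n<β = trans (cong (_% β 0) (n/1≡n n)) (m<n⇒m%n≡m n<β)

  digit-B-at : ∀ L → digit (B β L) L ≡ 1
  digit-B-at L = trans (cong (λ n → digit n L) (sym (+-identityʳ (B β L)))) (Assembled.digit-L 0 1 0 L (B≥1 L) (hβ L))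

  digit-B-below : ∀ L p → p < L → digit (B β L) p ≡ 0
  digit-B-below L p p<L = trans (digit-%B (B β L) L p p<L) (trans (cong (λ n → digit n p) (n%n≡0 (B β L) {{B-nz L}})) (digit-zero p))

  ≤B⇒ : ∀ {y} L → y ≤ B β L → y ≡ B β L ⊎ digit y L ≡ 0
  ≤B⇒ {y} L y≤B with m≤n⇒m<n∨m≡n y≤B
  ... | inj₁ y<B = inj₂ (digit-above y<B ≤-refl)
  ... | inj₂ y≡B = inj₁ y≡B

  ≤-of-split : ∀ {x y c} → x ≡ y + c → y ≤ x
  ≤-of-split {y = y} {c} x≡y+c = subst (y ≤_) (sym x≡y+c) (m≤m+n y c)

  c≡0⇒y≡x : ∀ {x y c} → x ≡ y + c → c ≡ 0 → y ≡ x
  c≡0⇒y≡x {y = y} x≡y+c refl = sym (trans x≡y+c (+-identityʳ y))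

  -- Witness at a level L ≥ 1: B_L in the first j ≤ min(k, β_L) components. A move to value 0 must
  -- lower the level-L digit sum j to a multiple of β_L, i.e. to 0, hence touch all j components.
  module AboveWitness {k} L j (1≤L : 1 ≤ L) (1≤j : 1 ≤ j) (j≤k : j ≤ suc k) (j≤β : j ≤ β L) where
    X : Vector ℕ (suc k)
    X i = firstOnes j i * B β L

    X-cases : ∀ i → (firstOnes j i ≡ 0 × X i ≡ 0) ⊎ (firstOnes j i ≡ 1 × X i ≡ B β L)
    X-cases i with toℕ i <ᵇ j
    ... | true = inj₂ (refl , +-identityʳ (B β L))
    ... | false = inj₁ (refl , refl)

    X-digit : ∀ i p → p < L → digit (X i) p ≡ 0
    X-digit i p p<L with X-cases i
    ... | inj₁ (_ , Xi≡0) = trans (cong (λ n → digit n p) Xi≡0) (digit-zero p)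
    ... | inj₂ (_ , Xi≡B) = trans (cong (λ n → digit n p) Xi≡B) (digit-B-below L p p<L)

    X-first≡B : ∀ i → toℕ i < j → X i ≡ B β L
    X-first≡B i i<j = trans (cong (_* B β L) (firstOnes-1 j i i<j)) (+-identityʳ (B β L))

    X∈P : InPmis X
    X∈P = fz , λ X0≡0 → <⇒≢ (B≥1 L) (sym (trans (sym (X-first≡B fz 1≤j)) X0≡0))

    mordX : mord X ≡ just L
    mordX = IsMord⇒mord≡ X ((λ i p p< → X-digit i p p<) , fz ,
              λ dL≡0 → 0≢1+n (trans (sym dL≡0) (trans (cong (λ n → digit n L) (X-first≡B fz 1≤j)) (digit-B-at L))))

    -- at level 0 φ X shows β_0 − 1
    φX≢0 : φ (suc k) X ≢ 0
    φX≢0 = φ≢0-byDigit X 0 λ d≡0 → <⇒≱ (hβ 0) (m∸n≡0⇒m≤n (trans (sym ([β∸1]%β 0))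
             (trans (cong (λ s → (s + (β 0 ∸ 1)) % β 0) (sym (∑-zero (λ i → X-digit i 0 1≤L))))
               (trans (sym (digit-φ-below X mordX 0 z≤n)) d≡0))))

    module _ (Y c : Vector ℕ (suc k)) (Y∈P : InPmis Y) (X≡Y+c : ∀ i → X i ≡ Y i + c i) (φY≡0 : φ (suc k) Y ≡ 0) where
      -- each component of Y is 0 or at most B_L, so its level-L digit is bounded by that of X
      digitL≤ : ∀ i → digit (Y i) L ≤ firstOnes j i
      digitL≤ i with X-cases i | ≤-of-split (X≡Y+c i)
      ... | inj₁ (_ , Xi≡0) | Yi≤ = subst (_≤ firstOnes j i) (sym (trans (cong (λ n → digit n L) (n≤0⇒n≡0 (subst (Y i ≤_) Xi≡0 Yi≤))) (digit-zero L))) z≤n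
      ... | inj₂ (ones≡1 , Xi≡B) | Yi≤ with ≤B⇒ L (subst (Y i ≤_) Xi≡B Yi≤)
      ...   | inj₁ Yi≡B = ≤-reflexive (trans (cong (λ n → digit n L) Yi≡B) (trans (digit-B-at L) (sym ones≡1)))
      ...   | inj₂ dL≡0 = subst (_≤ firstOnes j i) (sym dL≡0) z≤n

      -- a component with a nonzero level-0 digit lies among the first j but is not B_L
      strictSomewhere : ∃ λ i → digit (Y i) L < firstOnes j i
      strictSomewhere with ∑≢0⇒∃≢0 (λ i → digit (Y i) 0)
                             (λ sum≡0 → 0≢1+n (trans (sym (0%β 0)) (trans (cong (_% β 0) (sym sum≡0)) (φ≡0⇒sum₀≡1 Y Y∈P φY≡0))))
      ... | i , d0≢0 with X-cases i | ≤-of-split (X≡Y+c i)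
      ...   | inj₁ (_ , Xi≡0) | Yi≤ = contradiction (trans (cong (λ n → digit n 0) (n≤0⇒n≡0 (subst (Y i ≤_) Xi≡0 Yi≤))) (digit-zero 0)) d0≢0
      ...   | inj₂ (ones≡1 , Xi≡B) | Yi≤ with ≤B⇒ L (subst (Y i ≤_) Xi≡B Yi≤)
      ...     | inj₁ Yi≡B = contradiction (trans (cong (λ n → digit n 0) Yi≡B) (digit-B-below L 0 1≤L)) d0≢0
      ...     | inj₂ dL≡0 = i , subst₂ _<_ (sym dL≡0) (sym ones≡1) (s≤s z≤n)

      -- so the level-L digit sum of Y is below j ≤ β_L and ≡ 0, hence 0
      sumL≡0 : digitSum Y L ≡ 0
      sumL≡0 = trans (sym (m<n⇒m%n≡m (≤-trans sum<j j≤β))) (φ≡0⇒sum≡0 Y Y∈P φY≡0 L 1≤L)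
        where
        sum<j : digitSum Y L < j
        sum<j = ≤-trans (∑-mono-< digitL≤ (proj₁ strictSomewhere) (proj₂ strictSomewhere))
                  (≤-reflexive (trans (∑-firstOnes j) (m≤n⇒m⊓n≡m j≤k)))

      -- an untouched component among the first j would keep its digit 1 at level L
      touched : ∀ i → toℕ i < j → c i ≢ 0
      touched i i<j ci≡0 = <⇒≢ (≤-trans (≤-reflexive (sym digit≡1)) (≤∑ (λ i → digit (Y i) L) i)) (sym sumL≡0)
        where
        digit≡1 : digit (Y i) L ≡ 1
        digit≡1 = trans (cong (λ n → digit n L) (trans (c≡0⇒y≡x (X≡Y+c i) ci≡0) (X-first≡B i i<j))) (digit-B-at L)

      heavy : j ≤ wtv c
      heavy = wtv-firstOnes j c j≤k touched

  witness-above0 : ∀ {k} L j → 1 ≤ L → 1 ≤ j → j ≤ k → j ≤ β L → WeightWitness k j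
  witness-above0 {zero} L j 1≤L 1≤j j≤k j≤β = contradiction j≤k (<⇒≱ 1≤j)
  witness-above0 {suc k} L j 1≤L 1≤j j≤k j≤β = X , X∈P , φX≢0 , heavy
    where open AboveWitness L j 1≤L 1≤j j≤k j≤β

  -- For positions with components below β_0 and total at most β_0, φ is visible at level 0.
  module Level0 {k} (X : Vector ℕ k) (X<β : ∀ i → X i < β 0) (∑X≤β : ∑ X ≤ β 0) where
    digitSum₀ : ∀ (Y : Vector ℕ k) → (∀ i → Y i ≤ X i) → digitSum Y 0 ≡ ∑ Y
    digitSum₀ Y Y≤X = ∑-cong (λ i → digit₀-small (Y i) (≤-<-trans (Y≤X i) (X<β i)))

    value0⇒∑≡1 : ∀ (Y : Vector ℕ k) → InPmis Y → (∀ i → Y i ≤ X i) → φ k Y ≡ 0 → ∑ Y ≡ 1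
    value0⇒∑≡1 Y Y∈P Y≤X φY≡0 =
      m≤n∧m%n≡1⇒m≡1 (≤-trans (∑-mono Y≤X) ∑X≤β) (trans (cong (_% β 0) (sym (digitSum₀ Y Y≤X))) (φ≡0⇒sum₀≡1 Y Y∈P φY≡0))

    φ≢0 : InPmis X → 2 ≤ ∑ X → φ k X ≢ 0
    φ≢0 (i , Xi≢0) 2≤∑X = φ≢0-byDigit X 0 digit₀≢0
      where
      s = ∑ X ∸ 1
      ∑X≡ : ∑ X ≡ suc s
      ∑X≡ = trans (sym (m∸n+n≡m (≤-trans (s≤s z≤n) 2≤∑X))) (+-comm s 1)
      mordX : mord X ≡ just 0
      mordX = IsMord⇒mord≡ X ((λ i p ()) , i , λ d≡0 → Xi≢0 (trans (sym (digit₀-small (X i) (X<β i))) d≡0))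
      digit₀≢0 : digit (φ k X) 0 ≢ 0
      digit₀≢0 d≡0 = <⇒≢ (m+n≤o⇒m≤o∸n 1 2≤∑X) (sym (begin
        s                                   ≡⟨ [1+v+[n∸1]]%n≡v s (β 0) (subst (_≤ β 0) ∑X≡ ∑X≤β) ⟨
        (suc s + (β 0 ∸ 1)) % β 0           ≡⟨ cong (λ t → (t + (β 0 ∸ 1)) % β 0) (trans (sym ∑X≡) (sym (digitSum₀ X (λ _ → ≤-refl)))) ⟩
        (digitSum X 0 + (β 0 ∸ 1)) % β 0    ≡⟨ digit-φ-below X mordX 0 z≤n ⟨
        digit (φ k X) 0                     ≡⟨ d≡0 ⟩
        0                                   ∎))
        where open ≡-Reasoning

  -- Witness at level 0 when 2k ≤ β_0: all components 2. A move to value 0 leaves total 1,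
  -- so no component can keep its 2.
  witness-level0-twos : ∀ {k} → 2 ≤ k → 2 * k ≤ β 0 → WeightWitness k k
  witness-level0-twos {suc k} 2≤k 2k≤β = X , X∈P , φ≢0 X∈P 2≤∑X , heavy
    where
    X : Vector ℕ (suc k)
    X _ = 2
    ∑X≡ : ∑ X ≡ suc k * 2
    ∑X≡ = ∑-const {suc k} 2
    ∑X≤β : ∑ X ≤ β 0
    ∑X≤β = ≤-trans (≤-reflexive (trans ∑X≡ (*-comm (suc k) 2))) 2k≤β
    2<β : 2 < β 0
    2<β = <-≤-trans (s≤s (s≤s (s≤s z≤n))) (≤-trans (*-monoʳ-≤ 2 2≤k) 2k≤β)
    open Level0 X (λ _ → 2<β) ∑X≤β
    X∈P : InPmis X
    X∈P = fz , λ ()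
    2≤∑X : 2 ≤ ∑ X
    2≤∑X = ≤∑ X fz
    heavy : ∀ (Y c : Vector ℕ (suc k)) → InPmis Y → (∀ i → X i ≡ Y i + c i) → φ (suc k) Y ≡ 0 → suc k ≤ wtv c
    heavy Y c Y∈P X≡Y+c φY≡0 = wtv-firstOnes (suc k) c ≤-refl untouched⇒⊥
      where
      untouched⇒⊥ : ∀ i → toℕ i < suc k → c i ≢ 0
      untouched⇒⊥ i _ ci≡0 = <⇒≢ (≤-trans (≤-reflexive (sym (c≡0⇒y≡x (X≡Y+c i) ci≡0))) (≤∑ Y i))
                                 (sym (value0⇒∑≡1 Y Y∈P (λ i → ≤-of-split (X≡Y+c i)) φY≡0))

  -- Witness at level 0: the first j + 1 components equal 1. A move to value 0 leaves total 1,
  -- so it removes j single units from distinct components.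
  witness-level0-ones : ∀ {k} j → 1 ≤ j → suc j ≤ k → suc j ≤ β 0 → WeightWitness k j
  witness-level0-ones {suc k} j 1≤j 1+j≤k 1+j≤β = X , X∈P , φ≢0 X∈P (subst (2 ≤_) (sym ∑X≡) (s≤s 1≤j)) , heavy
    where
    X : Vector ℕ (suc k)
    X i = firstOnes (suc j) i
    ∑X≡ : ∑ X ≡ suc j
    ∑X≡ = trans (∑-firstOnes (suc j)) (m≤n⇒m⊓n≡m 1+j≤k)
    open Level0 X (λ i → ≤-<-trans (firstOnes≤1 (suc j) i) (hβ 0)) (≤-trans (≤-reflexive ∑X≡) 1+j≤β)
    X∈P : InPmis X
    X∈P = fz , λ X0≡0 → 0≢1+n (trans (sym X0≡0) (firstOnes-1 {suc k} (suc j) fz (s≤s z≤n)))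
    heavy : ∀ (Y c : Vector ℕ (suc k)) → InPmis Y → (∀ i → X i ≡ Y i + c i) → φ (suc k) Y ≡ 0 → j ≤ wtv c
    heavy Y c Y∈P X≡Y+c φY≡0 = ≤-reflexive (sym (trans (wtv-01 c c≤1) ∑c≡j))
      where
      c≤1 : ∀ i → c i ≤ 1
      c≤1 i = ≤-trans (subst (c i ≤_) (sym (X≡Y+c i)) (m≤n+m (c i) (Y i))) (firstOnes≤1 (suc j) i)
      ∑c≡j : ∑ c ≡ j
      ∑c≡j = suc-injective (begin
        suc (∑ c)        ≡⟨ cong (_+ ∑ c) (value0⇒∑≡1 Y Y∈P (λ i → ≤-of-split (X≡Y+c i)) φY≡0) ⟨
        ∑ Y + ∑ c        ≡⟨ ∑-+ Y c ⟨
        ∑ (λ i → Y i + c i) ≡⟨ ∑-cong X≡Y+c ⟨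
        ∑ X              ≡⟨ ∑X≡ ⟩
        suc j            ∎)
        where open ≡-Reasoning

  MoveSet : ∀ {k} → ℕ → Pred (Vec' k) 0ℓ
  MoveSet w c = Critical c × wtv c ≤ w

  Critical⇒InPmis : ∀ {k} (c : Vector ℕ k) → Critical c → InPmis c
  Critical⇒InPmis c (q , _ , sum%≢0) with ∑≢0⇒∃≢0 (λ i → digit (c i) q) (λ sum≡0 → sum%≢0 (trans (cong (_% β q) sum≡0) (0%β q)))
  ... | i , dq≢0 = i , λ ci≡0 → dq≢0 (trans (cong (λ n → digit n q) ci≡0) (digit-zero q))

  MoveSet∈Δ : ∀ {k} w → (∀ L → fβk β k L ≤ w) → InΔ (φ k) (MoveSet w)
  MoveSet∈Δ {k} w budget = (λ c c∈C → Critical⇒InPmis c (proj₁ c∈C)) , isSG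
    where
    isSG : IsSGof (MoveSet w) (φ k)
    isSG X X∈P = noOptionWithSameValue , everySmallerValue
      where
      noOptionWithSameValue : ¬ (∃ λ Y → Option (MoveSet w) X Y × φ k Y ≡ φ k X)
      noOptionWithSameValue (Y , (_ , Y∈P , c , (critical , _) , X≡Y+c) , φY≡φX) =
        critical-changes-φ X Y c X∈P Y∈P X≡Y+c critical (sym φY≡φX)
      everySmallerValue : ∀ v → v < φ k X → ∃ λ Y → Option (MoveSet w) X Y × φ k Y ≡ v
      everySmallerValue v v<φX with smaller-values-reachable w budget X X∈P v v<φX
      ... | Y , Y∈P , Y≤X , φY≡v , critical , weight =
            Y , (X∈P , Y∈P , (λ i → X i ∸ Y i) , (critical , weight) , (λ i → sym (m+[n∸m]≡n (Y≤X i)))) , φY≡v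

  fβk≤k : ∀ k L → fβk β k L ≤ k
  fβk≤k k L = ≤-trans (m⊓n≤n _ _) (m∸n≤m k (⟦ L ≡ᵇ 0 ⟧ * ⟦ β 0 <ᵇ 2 * k ⟧))

  -- Lower bound at level 0, by the witnesses at level 0 (or at level 1 when k = 1).
  weight≥fβk₀ : ∀ k → 1 ≤ k → ∀ C → InΔ (φ k) C → ∀ w → WtSetLE C w → fβk β k 0 ≤ w
  weight≥fβk₀ k 1≤k C C∈Δ w wtC≤w with β 0 <ᵇ 2 * k in β0<2k
  weight≥fβk₀ 1 1≤k C C∈Δ w wtC≤w | false =
    ≤-trans (m⊓n≤n (β 0 ∸ 1) 1) (witness⇒weight≥ (witness-above0 1 1 ≤-refl ≤-refl ≤-refl (β≥1 1)) C C∈Δ w wtC≤w)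
  weight≥fβk₀ (suc (suc k)) 1≤k C C∈Δ w wtC≤w | false =
    ≤-trans (m⊓n≤n (β 0 ∸ 1) (suc (suc k))) (witness⇒weight≥ (witness-level0-twos (s≤s (s≤s z≤n)) 2k≤β) C C∈Δ w wtC≤w)
    where
    2k≤β : 2 * suc (suc k) ≤ β 0
    2k≤β = ≮⇒≥ (λ β<2k → subst T β0<2k (<⇒<ᵇ β<2k))
  weight≥fβk₀ k 1≤k C C∈Δ w wtC≤w | true with (β 0 ∸ 1) ⊓ (k ∸ 1) in f≡
  ... | zero = z≤n
  ... | suc j = witness⇒weight≥ (witness-level0-ones (suc j) (s≤s z≤n) 2+j≤k 2+j≤β) C C∈Δ w wtC≤w
    where
    2+j≤k : suc (suc j) ≤ k
    2+j≤k = subst (suc (suc j) ≤_) (trans (+-comm 1 (k ∸ 1)) (m∸n+n≡m 1≤k)) (s≤s (subst (_≤ k ∸ 1) f≡ (m⊓n≤n (β 0 ∸ 1) (k ∸ 1))))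
    2+j≤β : suc (suc j) ≤ β 0
    2+j≤β = subst (suc (suc j) ≤_) (trans (+-comm 1 (β 0 ∸ 1)) (m∸n+n≡m (β≥1 0))) (s≤s (subst (_≤ β 0 ∸ 1) f≡ (m⊓n≤m (β 0 ∸ 1) (k ∸ 1))))

  weight≥fβk : ∀ k → 1 ≤ k → ∀ L C → InΔ (φ k) C → ∀ w → WtSetLE C w → fβk β k L ≤ w
  weight≥fβk k 1≤k zero = weight≥fβk₀ k 1≤k
  weight≥fβk k 1≤k (suc L) =
    witness⇒weight≥ (witness-above0 (suc L) (β (suc L) ⊓ k) (s≤s z≤n) (⊓-glb (β≥1 (suc L)) 1≤k) (m⊓n≤n _ _) (m⊓n≤m _ _))

mainTheorem2 : (β : ℕ → ℕ) (hβ : ∀ L → 2 ≤ β L) (k : ℕ) → 1 ≤ k →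
      (Σ (Pred (Vec' k) 0ℓ) λ C → InΔ (Mixed.φ β hβ k) C)
    × (∀ w → IsMaxOf (fβk β k) w → WtEq (Mixed.φ β hβ k) w)
mainTheorem2 β hβ k 1≤k =
  (MoveSet k , MoveSet∈Δ k (fβk≤k k)) ,
  λ w ((L , fL≡w) , budget) →
    (MoveSet w , MoveSet∈Δ w budget , λ c c∈C → proj₂ c∈C) ,
    λ C C∈Δ m wtC≤m → subst (_≤ m) fL≡w (weight≥fβk k 1≤k L C C∈Δ m wtC≤m)
  where open Radix β hβ
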